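{- For every $n\ge 3$, \[ H_n(x)=\sum_{k=0}^{\lfloor n/2\rfloor}\left(\binom{k+1}{n-2k}+\binom{k}{n-2k-1}\right)x^k, \qquad\text{i.e.}\qquad h_{n,k}=\binom{k+1}{n-2k}+\binom{k}{n-2k-1}. \]
   Context: For $n\ge 0$, the $S$-fence $\phi_n$ is the poset on $\{x_1,\dots,x_n\}$ whose order is generated by the cover relations $x_2<x_1$, $x_3<x_2$, $x_2<x_4$, $x_5<x_4$, and, for every $i\ge 3$, $x_{2i-1}<x_{2i}$ and $x_{2i+1}<x_{2i}$, keeping only those relations whose elements both have index $\le n$. A filter is an up-set. $\Phi_n$ is the underlying undirected graph of the Hasse diagram of the lattice of filters of $\phi_n$ ordered by reverse inclusion (two filters adjacent iff they differ in exactly one element). A maximal $k$-dimensional cube of $\Phi_n$ is an induced subgraph isomorphic to the hypercube $Q_k$ not contained in any induced hypercube subgraph of larger dimension; $h_{n,k}$ is their number and $H_n(x)=\sum_{k\ge0}h_{n,k}x^k$. Convention: $\binom{a}{b}=0$ unless $0\le b\le a$. -}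

module Defs where

open import Data.Nat using (ℕ; zero; suc; _+_; _*_; _<_; _≤_)
open import Data.Nat.Combinatorics using (_C_)
open import Data.Integer as ℤ using (ℤ; +_; -[1+_])
open import Data.Bool using (Bool; true; false)
open import Data.Fin using (Fin; toℕ)
open import Data.Vec using (Vec; lookup)
open import Data.List using (List; length)
open import Data.List.Relation.Unary.All using (All)
open import Data.List.Relation.Unary.Any using (Any)
open import Data.List.Relation.Unary.AllPairs using (AllPairs)
open import Data.Product using (Σ; _×_; ∃; ∃-syntax)
open import Relation.Binary.PropositionalEquality using (_≡_; _≢_)
open import Relation.Binary.Construct.Closure.ReflexiveTransitive using (Star)
open import Relation.Nullary using (¬_)
open import Function.Bundles using (_⇔_)

-- Cov a b  means the (1-based) cover relation  x_a < x_b :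
--   x_2<x_1, x_3<x_2, x_2<x_4, x_5<x_4, and for i ≥ 3 (i = j+3):
--   x_{2i-1} < x_{2i}  (i.e. x_{5+2j} < x_{6+2j})
--   x_{2i+1} < x_{2i}  (i.e. x_{7+2j} < x_{6+2j})

data Cov : ℕ → ℕ → Set where
  c21 : Cov 2 1
  c32 : Cov 3 2
  c24 : Cov 2 4
  c54 : Cov 5 4
  cOdd₁ : ∀ j → Cov (5 + 2 * j) (6 + 2 * j)
  cOdd₂ : ∀ j → Cov (7 + 2 * j) (6 + 2 * j)

-- elements of φ_n: Fin n, where i : Fin n stands for x_{toℕ i + 1};
-- only relations with both indices ≤ n are kept.
CovF : (n : ℕ) → Fin n → Fin n → Set
CovF n a b = Cov (suc (toℕ a)) (suc (toℕ b))

Leφ : (n : ℕ) → Fin n → Fin n → Set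
Leφ n = Star (CovF n)

Sub : ℕ → Set
Sub n = Vec Bool n

_∈ˢ_ : {n : ℕ} → Fin n → Sub n → Set
a ∈ˢ S = lookup S a ≡ true

IsFilter : (n : ℕ) → Sub n → Set
IsFilter n S = ∀ (a b : Fin n) → Leφ n a b → a ∈ˢ S → b ∈ˢ S

DifferInExactlyOne : {m : ℕ} → Vec Bool m → Vec Bool m → Set
DifferInExactlyOne {m} u v =
  Σ (Fin m) λ i → (lookup u i ≢ lookup v i) × (∀ j → j ≢ i → lookup u j ≡ lookup v j)

AdjΦ : (n : ℕ) → Sub n → Sub n → Set
AdjΦ n S T = IsFilter n S × IsFilter n T × DifferInExactlyOne S T

AdjQ : (k : ℕ) → Vec Bool k → Vec Bool k → Set
AdjQ k u v = DifferInExactlyOne u v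

VSet : ℕ → Set
VSet n = Sub n → Bool

_∈ᵛ_ : {n : ℕ} → Sub n → VSet n → Set
S ∈ᵛ W = W S ≡ true

_⊆ᵛ_ : {n : ℕ} → VSet n → VSet n → Set
W ⊆ᵛ W' = ∀ S → S ∈ᵛ W → S ∈ᵛ W'

_≐_ : {n : ℕ} → VSet n → VSet n → Set
W ≐ W' = ∀ S → W S ≡ W' S

IsInducedCube : (n k : ℕ) → VSet n → Set
IsInducedCube n k W =
  (∀ S → S ∈ᵛ W → IsFilter n S) ×
  Σ (Vec Bool k → Sub n) λ f →
    (∀ u → f u ∈ᵛ W) ×
    (∀ u v → f u ≡ f v → u ≡ v) ×
    (∀ S → S ∈ᵛ W → ∃[ u ] f u ≡ S) ×
    (∀ u v → AdjQ k u v ⇔ AdjΦ n (f u) (f v))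

IsMaxCube : (n k : ℕ) → VSet n → Set
IsMaxCube n k W =
  IsInducedCube n k W ×
  (∀ k' W' → k < k' → IsInducedCube n k' W' → ¬ (W ⊆ᵛ W'))

HasCount : {n : ℕ} → (VSet n → Set) → ℕ → Set
HasCount {n} P c =
  Σ (List (VSet n)) λ L →
    (length L ≡ c) ×
    AllPairs (λ W W' → ¬ (W ≐ W')) L ×
    All P L ×
    (∀ W → P W → Any (λ W' → W ≐ W') L)

h≡ : (n k c : ℕ) → Set
h≡ n k c = HasCount (IsMaxCube n k) c

-- binomial with integer arguments: binom a b = 0 unless 0 ≤ b ≤ a
binom : ℤ → ℤ → ℕ
binom (+ a) (+ b) = a C b
binom _ _ = 0

-- A cube of the filter graph Φ_n is an interval {S | I ⊆ S ⊆ I ∪ F} given by labelling every element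
-- inside (I), free (F) or outside: in an induced cube parallel edges toggle the same coordinate, so
-- the k edge directions are the free elements and every other coordinate is constant. The interval
-- consists of filters iff every cover a < b has b inside or a outside, and it is a maximal cube iff no
-- fixed element can be freed, i.e. every outside element has an upper cover that is not inside and
-- every inside element has a lower cover that is not outside. So h_{n,k} counts these valid
-- labellings with k free elements. In the S-fence only three labellings of x₁ x₂ x₃ survive, and
-- x₄ > x₅ < x₆ > ⋯ is a zigzag on which validity is local: it is recognised by a three-state
-- automaton whose counts, by length and number of free labels, obey Pascal recurrences solved by
-- the binomial coefficients of the statement.

module Submission where

open import Defs
open import Data.Nat using (ℕ; zero; suc; _+_; _*_; _≤_; _<_; _≡ᵇ_; z≤n; s≤s)
open import Data.Nat.Properties
  using (<⇒≢; <⇒≱; n<1+n; ≤-antisym; ≮⇒≥; *-suc; +-identityʳ; +-comm; +-assoc; m≤n+m; ≡ᵇ⇒≡; ≡⇒≡ᵇ)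
open import Data.Nat.Combinatorics using (_C_; nCk+nC[k+1]≡[n+1]C[k+1]; k>n⇒nCk≡0)
open import Data.Integer as ℤ using (ℤ; +_; -[1+_])
open import Data.Integer.Properties using (pos-+; pos-*)
open import Data.Integer.Tactic.RingSolver using (solve-∀)
open import Data.Bool using (Bool; true; false; not; _∧_; _xor_; T; if_then_else_)
open import Data.Bool.Properties
  using (not-¬; ¬-not; not-involutive; not-distribˡ-xor; xor-assoc; xor-same; xor-identityʳ; T-∧; ∧-zeroʳ)
  renaming (_≟_ to _≟ᵇ_)
open import Data.Fin using (Fin; zero; suc; toℕ)
open import Data.Fin.Properties using (injective⇒≤; any?; suc-injective) renaming (_≟_ to _≟ᶠ_)
open import Data.Vec using (Vec; []; _∷_; lookup; replicate; tabulate; _[_]%=_; _[_]≔_)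
open import Data.Vec.Properties
  using (lookup-replicate; lookup∘tabulate; lookup∘updateAt; lookup∘updateAt′; tabulate∘lookup; tabulate-cong;
         ∷-injectiveˡ; ∷-injectiveʳ)
open import Data.Maybe using (Maybe; just; nothing)
open import Data.List using (List; []; _∷_; _++_; map; length)
open import Data.List.Properties using (length-++; length-map)
open import Data.List.Membership.Propositional using (_∈_)
open import Data.List.Relation.Unary.All as All using (All; []; _∷_)
import Data.List.Relation.Unary.All.Properties as Allₚ
open import Data.List.Relation.Unary.Any as Any using (Any; here; there)
import Data.List.Relation.Unary.Any.Properties as Anyₚ
open import Data.List.Relation.Unary.AllPairs as AllPairs using (AllPairs; []; _∷_)
import Data.List.Relation.Unary.AllPairs.Properties as AllPairsₚ
open import Data.Product using (Σ-syntax; _×_; _,_; proj₁; proj₂; ∃-syntax)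
open import Data.Sum using (_⊎_; inj₁; inj₂)
open import Data.Empty using (⊥; ⊥-elim)
open import Data.Unit using (⊤; tt)
open import Function using (_∘_; _∘′_; case_of_)
open import Function.Bundles using (_⇔_; mk⇔; Equivalence)
open import Function.Construct.Symmetry using (⇔-sym)
open import Relation.Binary.Construct.Closure.ReflexiveTransitive using (ε; _◅_)
open import Relation.Binary.PropositionalEquality
open import Relation.Nullary
  using (¬_; Dec; yes; no; does; isYes; contradiction; _×-dec_; _⊎-dec_; _→-dec_; ¬?; T?; map′)
open import Relation.Nullary.Decidable using (toWitness; fromWitness)

open ≡-Reasoning

private
  variable
    m n k : ℕ

-- Toggling coordinates of Boolean vectors

lookup-ext : ∀ {A : Set} (u v : Vec A n) → (∀ i → lookup u i ≡ lookup v i) → u ≡ v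
lookup-ext u v h = trans (sym (tabulate∘lookup u)) (trans (tabulate-cong h) (tabulate∘lookup v))

toggle : Vec Bool n → Fin n → Vec Bool n
toggle v i = v [ i ]%= not

lookup-toggle : (v : Vec Bool n) (i : Fin n) → lookup (toggle v i) i ≡ not (lookup v i)
lookup-toggle v i = lookup∘updateAt i v

lookup-toggle-≢ : (v : Vec Bool n) {i j : Fin n} → j ≢ i → lookup (toggle v i) j ≡ lookup v j
lookup-toggle-≢ v {i} {j} j≢i = lookup∘updateAt′ j i j≢i v

toggle-involutive : (v : Vec Bool n) (i : Fin n) → toggle (toggle v i) i ≡ v
toggle-involutive (x ∷ v) zero    = cong (_∷ v) (not-involutive x)
toggle-involutive (x ∷ v) (suc i) = cong (x ∷_) (toggle-involutive v i)

toggle-comm : (v : Vec Bool n) (i j : Fin n) → toggle (toggle v i) j ≡ toggle (toggle v j) i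
toggle-comm (x ∷ v) zero    zero    = refl
toggle-comm (x ∷ v) zero    (suc j) = refl
toggle-comm (x ∷ v) (suc i) zero    = refl
toggle-comm (x ∷ v) (suc i) (suc j) = cong (x ∷_) (toggle-comm v i j)

toggle-injectiveʳ : (v : Vec Bool n) (i j : Fin n) → toggle v i ≡ toggle v j → i ≡ j
toggle-injectiveʳ v i j e with i ≟ᶠ j
... | yes i≡j = i≡j
... | no  i≢j = contradiction
  (trans (sym (lookup-toggle v i)) (trans (cong (λ w → lookup w i) e) (lookup-toggle-≢ v i≢j)))
  (not-¬ refl ∘′ sym)

DifferInExactlyOne⇒toggle : (u v : Vec Bool n) → DifferInExactlyOne u v → ∃[ i ] v ≡ toggle u i
DifferInExactlyOne⇒toggle u v (i , uᵢ≢vᵢ , rest) = i , lookup-ext v (toggle u i) same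
  where
  same : ∀ j → lookup v j ≡ lookup (toggle u i) j
  same j with j ≟ᶠ i
  ... | yes refl = trans (¬-not (uᵢ≢vᵢ ∘′ sym)) (sym (lookup-toggle u i))
  ... | no  j≢i  = trans (sym (rest j j≢i)) (sym (lookup-toggle-≢ u j≢i))

toggle⇒DifferInExactlyOne : (u : Vec Bool n) (i : Fin n) → DifferInExactlyOne u (toggle u i)
toggle⇒DifferInExactlyOne u i =
  i , (λ e → not-¬ refl (trans e (lookup-toggle u i))) , (λ j j≢i → sym (lookup-toggle-≢ u j≢i))

-- X and Y differ exactly in {a, q} and in {b, r}; as a ≢ b this forces q ≡ b.
toggle-square : (Y X : Vec Bool n) {a b q r : Fin n} → a ≢ b → X ≢ Y →
                X ≡ toggle (toggle Y a) q → X ≡ toggle (toggle Y b) r → X ≡ toggle (toggle Y a) b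
toggle-square Y X {a} {b} {q} {r} a≢b X≢Y X≡aq X≡br with q ≟ᶠ a | q ≟ᶠ b
... | yes refl | _        = contradiction (trans X≡aq (toggle-involutive Y a)) X≢Y
... | no  _    | yes refl = X≡aq
... | no  q≢a  | no  q≢b  = contradiction (trans (sym Xq-toggled) Xq-kept) (not-¬ refl ∘′ sym)
  where
  Xq-toggled : lookup X q ≡ not (lookup Y q)
  Xq-toggled = trans (cong (λ w → lookup w q) X≡aq)
                     (trans (lookup-toggle (toggle Y a) q) (cong not (lookup-toggle-≢ Y q≢a)))
  Xb-kept : r ≢ b → lookup X b ≡ not (lookup Y b)
  Xb-kept r≢b = trans (cong (λ w → lookup w b) X≡br)
                      (trans (lookup-toggle-≢ (toggle Y b) (r≢b ∘′ sym)) (lookup-toggle Y b))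
  Xb-orig : q ≢ b → lookup X b ≡ lookup Y b
  Xb-orig q≢b = trans (cong (λ w → lookup w b) X≡aq)
                      (trans (lookup-toggle-≢ (toggle Y a) (q≢b ∘′ sym)) (lookup-toggle-≢ Y (a≢b ∘′ sym)))
  Xq-kept : lookup X q ≡ lookup Y q
  Xq-kept with r ≟ᶠ q
  ... | yes refl = contradiction (trans (sym (Xb-orig q≢b)) (Xb-kept q≢b)) (not-¬ refl)
  ... | no  r≢q  = trans (cong (λ w → lookup w q) X≡br)
                         (trans (lookup-toggle-≢ (toggle Y b) (r≢q ∘′ sym)) (lookup-toggle-≢ Y q≢b))

toggle-induction : (P : Vec Bool k → Set) → P (replicate k false) →
                   (∀ u j → P u → P (toggle u j)) → ∀ u → P u
toggle-induction P base step []          = base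
toggle-induction P base step (false ∷ u) =
  toggle-induction (P ∘′ (false ∷_)) base (λ u j → step (false ∷ u) (suc j)) u
toggle-induction P base step (true ∷ u)  =
  step (false ∷ u) zero (toggle-induction (P ∘′ (false ∷_)) base (λ u j → step (false ∷ u) (suc j)) u)

module CubeEmbedding {f : Vec Bool k → Vec Bool n}
                     (f-injective : ∀ u v → f u ≡ f v → u ≡ v)
                     (f-edge : ∀ u j → ∃[ i ] f (toggle u j) ≡ toggle (f u) i) where

  edge-square : ∀ u {i j a b} → i ≢ j →
                f (toggle u i) ≡ toggle (f u) a → f (toggle u j) ≡ toggle (f u) b →
                f (toggle (toggle u i) j) ≡ toggle (toggle (f u) a) b
  edge-square u {i} {j} {a} {b} i≢j fᵢ fⱼ =
    toggle-square (f u) (f (toggle (toggle u i) j)) a≢b X≢fu X≡aq X≡br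
    where
    a≢b : a ≢ b
    a≢b a≡b = i≢j (toggle-injectiveʳ u i j
      (f-injective _ _ (trans fᵢ (trans (cong (toggle (f u)) a≡b) (sym fⱼ)))))
    X≢fu : f (toggle (toggle u i) j) ≢ f u
    X≢fu e = i≢j (toggle-injectiveʳ u i j
      (trans (sym (toggle-involutive (toggle u i) j)) (cong (λ w → toggle w j) (f-injective _ _ e))))
    X≡aq : f (toggle (toggle u i) j) ≡ toggle (toggle (f u) a) (proj₁ (f-edge (toggle u i) j))
    X≡aq = trans (proj₂ (f-edge (toggle u i) j)) (cong (λ w → toggle w _) fᵢ)
    X≡br : f (toggle (toggle u i) j) ≡ toggle (toggle (f u) b) (proj₁ (f-edge (toggle u j) i))
    X≡br = trans (cong f (toggle-comm u i j))
                 (trans (proj₂ (f-edge (toggle u j) i)) (cong (λ w → toggle w _) fⱼ))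

  direction : Fin k → Fin n
  direction j = proj₁ (f-edge (replicate k false) j)

  f-toggle : ∀ u j → f (toggle u j) ≡ toggle (f u) (direction j)
  f-toggle = toggle-induction (λ u → ∀ j → f (toggle u j) ≡ toggle (f u) (direction j))
                              (λ j → proj₂ (f-edge _ j)) step
    where
    step : ∀ u i → (∀ j → f (toggle u j) ≡ toggle (f u) (direction j)) →
           ∀ j → f (toggle (toggle u i) j) ≡ toggle (f (toggle u i)) (direction j)
    step u i IH j with i ≟ᶠ j
    ... | yes refl = trans (cong f (toggle-involutive u i))
                           (trans (sym (toggle-involutive (f u) (direction i)))
                                  (cong (λ w → toggle w (direction i)) (sym (IH i))))
    ... | no  i≢j  = trans (edge-square u i≢j (IH i) (IH j)) (cong (λ w → toggle w (direction j)) (sym (IH i)))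

  direction-injective : ∀ i j → direction i ≡ direction j → i ≡ j
  direction-injective i j e = toggle-injectiveʳ z i j (f-injective _ _
    (trans (f-toggle z i) (trans (cong (toggle (f z)) e) (sym (f-toggle z j)))))
    where
    z : Vec Bool k
    z = replicate k false

-- Labellings and the subcubes they span

data Label : Set where
  inside free outside : Label

_≟ˡ_ : (x y : Label) → Dec (x ≡ y)
inside  ≟ˡ inside  = yes refl
free    ≟ˡ free    = yes refl
outside ≟ˡ outside = yes refl
inside  ≟ˡ free    = no λ ()
inside  ≟ˡ outside = no λ ()
free    ≟ˡ inside  = no λ ()
free    ≟ˡ outside = no λ ()
outside ≟ˡ inside  = no λ ()
outside ≟ˡ free    = no λ ()

Labelling : ℕ → Set
Labelling n = Vec Label n

dim : Labelling n → ℕ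
dim []              = 0
dim (free ∷ ℓ)      = suc (dim ℓ)
dim (inside ∷ ℓ)    = dim ℓ
dim (outside ∷ ℓ)   = dim ℓ

fits : Label → Bool → Bool
fits inside  x = x
fits free    x = true
fits outside x = not x

cubeOf : Labelling n → VSet n
cubeOf []      []      = true
cubeOf (l ∷ ℓ) (x ∷ S) = fits l x ∧ cubeOf ℓ S

fill : (ℓ : Labelling n) → Vec Bool (dim ℓ) → Vec Bool n
fill []            u       = []
fill (inside ∷ ℓ)  u       = true ∷ fill ℓ u
fill (outside ∷ ℓ) u       = false ∷ fill ℓ u
fill (free ∷ ℓ)    (x ∷ u) = x ∷ fill ℓ u

restrict : (ℓ : Labelling n) → Vec Bool n → Vec Bool (dim ℓ)
restrict []            []      = []
restrict (inside ∷ ℓ)  (x ∷ S) = restrict ℓ S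
restrict (outside ∷ ℓ) (x ∷ S) = restrict ℓ S
restrict (free ∷ ℓ)    (x ∷ S) = x ∷ restrict ℓ S

fill-∈ : ∀ (ℓ : Labelling n) u → fill ℓ u ∈ᵛ cubeOf ℓ
fill-∈ []            u       = refl
fill-∈ (inside ∷ ℓ)  u       = fill-∈ ℓ u
fill-∈ (outside ∷ ℓ) u       = fill-∈ ℓ u
fill-∈ (free ∷ ℓ)    (x ∷ u) = fill-∈ ℓ u

restrict-fill : ∀ (ℓ : Labelling n) u → restrict ℓ (fill ℓ u) ≡ u
restrict-fill []            []      = refl
restrict-fill (inside ∷ ℓ)  u       = restrict-fill ℓ u
restrict-fill (outside ∷ ℓ) u       = restrict-fill ℓ u
restrict-fill (free ∷ ℓ)    (x ∷ u) = cong (x ∷_) (restrict-fill ℓ u)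

fill-restrict : ∀ (ℓ : Labelling n) S → S ∈ᵛ cubeOf ℓ → fill ℓ (restrict ℓ S) ≡ S
fill-restrict []            []          _ = refl
fill-restrict (inside ∷ ℓ)  (true ∷ S)  m = cong (true ∷_) (fill-restrict ℓ S m)
fill-restrict (outside ∷ ℓ) (false ∷ S) m = cong (false ∷_) (fill-restrict ℓ S m)
fill-restrict (free ∷ ℓ)    (x ∷ S)     m = cong (x ∷_) (fill-restrict ℓ S m)

fill-injective : ∀ (ℓ : Labelling n) u v → fill ℓ u ≡ fill ℓ v → u ≡ v
fill-injective ℓ u v e = trans (sym (restrict-fill ℓ u)) (trans (cong (restrict ℓ) e) (restrict-fill ℓ v))

∧-true⁻ˡ : ∀ {a b} → a ∧ b ≡ true → a ≡ true
∧-true⁻ˡ {true} _ = refl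

∧-true⁻ʳ : ∀ {a b} → a ∧ b ≡ true → b ≡ true
∧-true⁻ʳ {true} e = e

∧-true⁺ : ∀ {a b} → a ≡ true → b ≡ true → a ∧ b ≡ true
∧-true⁺ refl refl = refl

∈-cubeOf⁻ : ∀ (ℓ : Labelling n) S → S ∈ᵛ cubeOf ℓ → ∀ i → fits (lookup ℓ i) (lookup S i) ≡ true
∈-cubeOf⁻ (l ∷ ℓ) (x ∷ S) m zero    = ∧-true⁻ˡ m
∈-cubeOf⁻ (l ∷ ℓ) (x ∷ S) m (suc i) = ∈-cubeOf⁻ ℓ S (∧-true⁻ʳ {fits l x} m) i

∈-cubeOf⁺ : ∀ (ℓ : Labelling n) S → (∀ i → fits (lookup ℓ i) (lookup S i) ≡ true) → S ∈ᵛ cubeOf ℓ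
∈-cubeOf⁺ []      []      h = refl
∈-cubeOf⁺ (l ∷ ℓ) (x ∷ S) h = ∧-true⁺ (h zero) (∈-cubeOf⁺ ℓ S (λ i → h (suc i)))

∈-inside : ∀ (ℓ : Labelling n) {S} → S ∈ᵛ cubeOf ℓ →
           ∀ {i} → lookup ℓ i ≡ inside → lookup S i ≡ true
∈-inside ℓ {S} m {i} e = subst (λ l → fits l (lookup S i) ≡ true) e (∈-cubeOf⁻ ℓ S m i)

∈-outside : ∀ (ℓ : Labelling n) {S} → S ∈ᵛ cubeOf ℓ →
            ∀ {i} → lookup ℓ i ≡ outside → lookup S i ≡ false
∈-outside ℓ {S} m {i} e =
  not-true⇒false (subst (λ l → fits l (lookup S i) ≡ true) e (∈-cubeOf⁻ ℓ S m i))
  where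
  not-true⇒false : ∀ {x} → not x ≡ true → x ≡ false
  not-true⇒false {false} _ = refl

freeIndex : ∀ (ℓ : Labelling n) i → lookup ℓ i ≡ free → Fin (dim ℓ)
freeIndex (free ∷ ℓ)    zero    _ = zero
freeIndex (inside ∷ ℓ)  (suc i) e = freeIndex ℓ i e
freeIndex (outside ∷ ℓ) (suc i) e = freeIndex ℓ i e
freeIndex (free ∷ ℓ)    (suc i) e = suc (freeIndex ℓ i e)

freePosition : ∀ (ℓ : Labelling n) → Fin (dim ℓ) → Fin n
freePosition (inside ∷ ℓ)  j       = suc (freePosition ℓ j)
freePosition (outside ∷ ℓ) j       = suc (freePosition ℓ j)
freePosition (free ∷ ℓ)    zero    = zero
freePosition (free ∷ ℓ)    (suc j) = suc (freePosition ℓ j)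

freeIndex-injective : ∀ (ℓ : Labelling n) i j eᵢ eⱼ → freeIndex ℓ i eᵢ ≡ freeIndex ℓ j eⱼ → i ≡ j
freeIndex-injective (free ∷ ℓ)    zero    zero    _  _  _ = refl
freeIndex-injective (inside ∷ ℓ)  (suc i) (suc j) eᵢ eⱼ r = cong suc (freeIndex-injective ℓ i j eᵢ eⱼ r)
freeIndex-injective (outside ∷ ℓ) (suc i) (suc j) eᵢ eⱼ r = cong suc (freeIndex-injective ℓ i j eᵢ eⱼ r)
freeIndex-injective (free ∷ ℓ)    (suc i) (suc j) eᵢ eⱼ r =
  cong suc (freeIndex-injective ℓ i j eᵢ eⱼ (suc-injective r))

lookup-fill-free : ∀ (ℓ : Labelling n) u i (e : lookup ℓ i ≡ free) →
                   lookup (fill ℓ u) i ≡ lookup u (freeIndex ℓ i e)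
lookup-fill-free (free ∷ ℓ)    (x ∷ u) zero    e = refl
lookup-fill-free (inside ∷ ℓ)  u       (suc i) e = lookup-fill-free ℓ u i e
lookup-fill-free (outside ∷ ℓ) u       (suc i) e = lookup-fill-free ℓ u i e
lookup-fill-free (free ∷ ℓ)    (x ∷ u) (suc i) e = lookup-fill-free ℓ u i e

fill-toggle : ∀ (ℓ : Labelling n) u j → fill ℓ (toggle u j) ≡ toggle (fill ℓ u) (freePosition ℓ j)
fill-toggle (inside ∷ ℓ)  u       j       = cong (true ∷_) (fill-toggle ℓ u j)
fill-toggle (outside ∷ ℓ) u       j       = cong (false ∷_) (fill-toggle ℓ u j)
fill-toggle (free ∷ ℓ)    (x ∷ u) zero    = refl
fill-toggle (free ∷ ℓ)    (x ∷ u) (suc j) = cong (x ∷_) (fill-toggle ℓ u j)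

fill-toggle-free : ∀ (ℓ : Labelling n) u i (e : lookup ℓ i ≡ free) →
                   fill ℓ (toggle u (freeIndex ℓ i e)) ≡ toggle (fill ℓ u) i
fill-toggle-free (free ∷ ℓ)    (x ∷ u) zero    e = refl
fill-toggle-free (inside ∷ ℓ)  u       (suc i) e = cong (true ∷_) (fill-toggle-free ℓ u i e)
fill-toggle-free (outside ∷ ℓ) u       (suc i) e = cong (false ∷_) (fill-toggle-free ℓ u i e)
fill-toggle-free (free ∷ ℓ)    (x ∷ u) (suc i) e = cong (x ∷_) (fill-toggle-free ℓ u i e)

toggle-within-cubeOf : ∀ (ℓ : Labelling n) {S i} → S ∈ᵛ cubeOf ℓ → toggle S i ∈ᵛ cubeOf ℓ →
                       lookup ℓ i ≡ free
toggle-within-cubeOf ℓ {S} {i} S∈ S′∈ with lookup ℓ i in eq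
... | free    = refl
... | inside  = case trans (sym (∈-inside ℓ S′∈ eq)) (trans (lookup-toggle S i) (cong not (∈-inside ℓ S∈ eq)))
                of λ ()
... | outside = case trans (sym (∈-outside ℓ S′∈ eq)) (trans (lookup-toggle S i) (cong not (∈-outside ℓ S∈ eq)))
                of λ ()

bottom top : Labelling n → Vec Bool n
bottom ℓ = fill ℓ (replicate (dim ℓ) false)
top    ℓ = fill ℓ (replicate (dim ℓ) true)

bottom-∈ : ∀ (ℓ : Labelling n) → bottom ℓ ∈ᵛ cubeOf ℓ
bottom-∈ ℓ = fill-∈ ℓ _

top-∈ : ∀ (ℓ : Labelling n) → top ℓ ∈ᵛ cubeOf ℓ
top-∈ ℓ = fill-∈ ℓ _

lookup-bottom-free : ∀ (ℓ : Labelling n) {i} → lookup ℓ i ≡ free → lookup (bottom ℓ) i ≡ false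
lookup-bottom-free ℓ {i} e = trans (lookup-fill-free ℓ _ i e) (lookup-replicate (freeIndex ℓ i e) false)

lookup-top-free : ∀ (ℓ : Labelling n) {i} → lookup ℓ i ≡ free → lookup (top ℓ) i ≡ true
lookup-top-free ℓ {i} e = trans (lookup-fill-free ℓ _ i e) (lookup-replicate (freeIndex ℓ i e) true)

-- Maximal cubes of the filter graph are the subcubes of valid labellings

Cov-irreflexive : ∀ {a b} → Cov a b → a ≢ b
Cov-irreflexive (cOdd₁ j) e = <⇒≢ (n<1+n _) e
Cov-irreflexive (cOdd₂ j) e = <⇒≢ (n<1+n _) (sym e)

CovF-irreflexive : ∀ {a b : Fin n} → CovF n a b → a ≢ b
CovF-irreflexive c refl = Cov-irreflexive c refl

isFilter⁺ : (S : Sub n) → (∀ a b → CovF n a b → a ∈ˢ S → b ∈ˢ S) → IsFilter n S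
isFilter⁺ S up a .a ε        a∈S = a∈S
isFilter⁺ S up a b  (c ◅ cs) a∈S = isFilter⁺ S up _ b cs (up a _ c a∈S)

Compatible : (R : Fin n → Fin n → Set) → Labelling n → Set
Compatible R ℓ = ∀ a b → R a b → lookup ℓ b ≡ inside ⊎ lookup ℓ a ≡ outside

-- U and D mark the positions at which the two saturation conditions are imposed.
Admissible : (R : Fin n → Fin n → Set) (U D : Fin n → Set) → Labelling n → Set
Admissible R U D ℓ =
  Compatible R ℓ ×
  (∀ a → lookup ℓ a ≡ outside → U a → ¬ (∀ b → R a b → lookup ℓ b ≡ inside)) ×
  (∀ a → lookup ℓ a ≡ inside  → D a → ¬ (∀ c → R c a → lookup ℓ c ≡ outside))

Valid : Labelling n → Set
Valid {n} = Admissible (CovF n) (λ _ → ⊤) (λ _ → ⊤)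

∈-cubeOf⇒isFilter : ∀ (ℓ : Labelling n) → Compatible (CovF n) ℓ →
                    ∀ S → S ∈ᵛ cubeOf ℓ → IsFilter n S
∈-cubeOf⇒isFilter {n} ℓ compat S S∈ = isFilter⁺ S up
  where
  up : ∀ a b → CovF n a b → a ∈ˢ S → b ∈ˢ S
  up a b c a∈S with compat a b c
  ... | inj₁ b-in  = ∈-inside ℓ S∈ b-in
  ... | inj₂ a-out = contradiction (trans (sym a∈S) (∈-outside ℓ S∈ a-out)) λ ()

cubeOf-isInducedCube : ∀ (ℓ : Labelling n) → Compatible (CovF n) ℓ → IsInducedCube n (dim ℓ) (cubeOf ℓ)
cubeOf-isInducedCube {n} ℓ compat =
  ∈-cubeOf⇒isFilter ℓ compat , fill ℓ , fill-∈ ℓ , fill-injective ℓ ,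
  (λ S S∈ → restrict ℓ S , fill-restrict ℓ S S∈) , (λ u v → mk⇔ (to u v) (from u v))
  where
  isFilter-fill : ∀ u → IsFilter n (fill ℓ u)
  isFilter-fill u = ∈-cubeOf⇒isFilter ℓ compat _ (fill-∈ ℓ u)
  to : ∀ u v → AdjQ (dim ℓ) u v → AdjΦ n (fill ℓ u) (fill ℓ v)
  to u v d with DifferInExactlyOne⇒toggle u v d
  ... | j , refl = isFilter-fill u , isFilter-fill (toggle u j) ,
                   subst (DifferInExactlyOne (fill ℓ u)) (sym (fill-toggle ℓ u j))
                         (toggle⇒DifferInExactlyOne (fill ℓ u) (freePosition ℓ j))
  from : ∀ u v → AdjΦ n (fill ℓ u) (fill ℓ v) → AdjQ (dim ℓ) u v
  from u v (_ , _ , d) with DifferInExactlyOne⇒toggle (fill ℓ u) (fill ℓ v) d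
  ... | i , e = subst (DifferInExactlyOne u) (sym v≡) (toggle⇒DifferInExactlyOne u (freeIndex ℓ i i-free))
    where
    i-free : lookup ℓ i ≡ free
    i-free = toggle-within-cubeOf ℓ (fill-∈ ℓ u) (subst (_∈ᵛ cubeOf ℓ) e (fill-∈ ℓ v))
    v≡ : v ≡ toggle u (freeIndex ℓ i i-free)
    v≡ = fill-injective ℓ v _ (trans e (sym (fill-toggle-free ℓ u i i-free)))

module InducedCube {W : VSet n} (cube : IsInducedCube n k W) where

  W-filters : ∀ S → S ∈ᵛ W → IsFilter n S
  W-filters = proj₁ cube

  f : Vec Bool k → Sub n
  f = proj₁ (proj₂ cube)

  f∈W : ∀ u → f u ∈ᵛ W
  f∈W = proj₁ (proj₂ (proj₂ cube))

  f-injective : ∀ u v → f u ≡ f v → u ≡ v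
  f-injective = proj₁ (proj₂ (proj₂ (proj₂ cube)))

  f-onto : ∀ S → S ∈ᵛ W → ∃[ u ] f u ≡ S
  f-onto = proj₁ (proj₂ (proj₂ (proj₂ (proj₂ cube))))

  f-adjacent : ∀ u v → AdjQ k u v ⇔ AdjΦ n (f u) (f v)
  f-adjacent = proj₂ (proj₂ (proj₂ (proj₂ (proj₂ cube))))

  f-edge : ∀ u j → ∃[ i ] f (toggle u j) ≡ toggle (f u) i
  f-edge u j = DifferInExactlyOne⇒toggle (f u) (f (toggle u j))
    (proj₂ (proj₂ (Equivalence.to (f-adjacent u (toggle u j)) (toggle⇒DifferInExactlyOne u j))))

  toggle-preimage : ∀ u i → toggle (f u) i ∈ᵛ W → ∃[ m ] f (toggle u m) ≡ toggle (f u) i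
  toggle-preimage u i S∈W with f-onto _ S∈W
  ... | v , fv≡S with DifferInExactlyOne⇒toggle u v (Equivalence.from (f-adjacent u v) adjacent)
    where
    adjacent : AdjΦ n (f u) (f v)
    adjacent = W-filters _ (f∈W u) , W-filters _ (f∈W v) ,
               subst (DifferInExactlyOne (f u)) (sym fv≡S) (toggle⇒DifferInExactlyOne (f u) i)
  ... | m , refl = m , fv≡S

  open CubeEmbedding f-injective f-edge public

toggle-isFilter-upper : (S : Sub n) {a b : Fin n} → IsFilter n (toggle S a) → lookup S a ≡ false →
                        CovF n a b → lookup S b ≡ true
toggle-isFilter-upper S {a} {b} filt a∉S c =
  trans (sym (lookup-toggle-≢ S (CovF-irreflexive c ∘′ sym)))
        (filt a b (c ◅ ε) (trans (lookup-toggle S a) (cong not a∉S)))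

toggle-isFilter-lower : (S : Sub n) {a c : Fin n} → IsFilter n (toggle S a) → lookup S a ≡ true →
                        CovF n c a → lookup S c ≡ false
toggle-isFilter-lower S {a} {c} filt a∈S cv with lookup S c in c∈S
... | false = refl
... | true  = contradiction
  (trans (sym (filt c a (cv ◅ ε) (trans (lookup-toggle-≢ S (CovF-irreflexive cv)) c∈S)))
         (trans (lookup-toggle S a) (cong not a∈S)))
  λ ()

lookup-bottom-true : ∀ (ℓ : Labelling n) {i} → lookup (bottom ℓ) i ≡ true → lookup ℓ i ≡ inside
lookup-bottom-true ℓ {i} e with lookup ℓ i in eq
... | inside  = refl
... | free    = contradiction (trans (sym e) (lookup-bottom-free ℓ eq)) λ ()
... | outside = contradiction (trans (sym e) (∈-outside ℓ (bottom-∈ ℓ) eq)) λ ()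

module LargerCube (ℓ : Labelling n) (valid : Valid ℓ) {k′} {W′ : VSet n}
                  (cube′ : IsInducedCube n k′ W′) (cubeOf⊆W′ : cubeOf ℓ ⊆ᵛ W′) where

  open InducedCube cube′

  A : Sub n
  A = bottom ℓ

  u₀ : Vec Bool k′
  u₀ = proj₁ (f-onto A (cubeOf⊆W′ A (bottom-∈ ℓ)))

  fu₀ : f u₀ ≡ A
  fu₀ = proj₂ (f-onto A (cubeOf⊆W′ A (bottom-∈ ℓ)))

  P : Fin k′ → Fin n
  P j = proj₁ (f-edge u₀ j)

  f-neighbour : ∀ j → f (toggle u₀ j) ≡ toggle A (P j)
  f-neighbour j = trans (proj₂ (f-edge u₀ j)) (cong (λ S → toggle S (P j)) fu₀)

  neighbour-isFilter : ∀ j → IsFilter n (toggle A (P j))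
  neighbour-isFilter j = subst (IsFilter n) (f-neighbour j) (W-filters _ (f∈W (toggle u₀ j)))

  P-injective : ∀ i j → P i ≡ P j → i ≡ j
  P-injective i j e = toggle-injectiveʳ u₀ i j (f-injective _ _
    (trans (f-neighbour i) (trans (cong (toggle A) e) (sym (f-neighbour j)))))

  -- toggle (toggle A (P j)) c is the fourth corner of the square of W′ spanned at u₀ by the edges
  -- towards toggle A (P j) and toggle A c.
  square-isFilter : ∀ j {c} → lookup ℓ c ≡ free → c ≢ P j → IsFilter n (toggle (toggle A (P j)) c)
  square-isFilter j {c} c-free c≢P with toggle-preimage u₀ c
      (subst (_∈ᵛ W′) (trans (fill-toggle-free ℓ _ c c-free) (cong (λ S → toggle S c) (sym fu₀)))
             (cubeOf⊆W′ _ (fill-∈ ℓ _)))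
  ... | m , f-m = subst (IsFilter n) corner (W-filters _ (f∈W _))
    where
    f-m′ : f (toggle u₀ m) ≡ toggle A c
    f-m′ = trans f-m (cong (λ S → toggle S c) fu₀)
    j≢m : j ≢ m
    j≢m refl = c≢P (toggle-injectiveʳ A c (P j) (trans (sym f-m′) (f-neighbour j)))
    corner : f (toggle (toggle u₀ j) m) ≡ toggle (toggle A (P j)) c
    corner = trans (edge-square u₀ j≢m (proj₂ (f-edge u₀ j)) f-m)
                   (cong (λ S → toggle (toggle S (P j)) c) fu₀)

  neighbour-not-outside : ∀ j → lookup ℓ (P j) ≢ outside
  neighbour-not-outside j P-out = proj₁ (proj₂ valid) (P j) P-out _ λ b c →
    lookup-bottom-true ℓ (toggle-isFilter-upper A (neighbour-isFilter j) (∈-outside ℓ (bottom-∈ ℓ) P-out) c)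

  lower-covers-outside : ∀ j → lookup ℓ (P j) ≡ inside → ∀ c → CovF n c (P j) → lookup ℓ c ≡ outside
  lower-covers-outside j P-in c cv with lookup ℓ c in eq
  ... | outside = refl
  ... | inside  = contradiction (trans (sym (∈-inside ℓ (bottom-∈ ℓ) eq))
                                       (toggle-isFilter-lower A (neighbour-isFilter j) A-P cv)) λ ()
    where
    A-P : lookup A (P j) ≡ true
    A-P = ∈-inside ℓ (bottom-∈ ℓ) P-in
  ... | free    = contradiction (trans (sym P-in-square) P-out-square) λ ()
    where
    c≢P : c ≢ P j
    c≢P = CovF-irreflexive cv
    P-in-square : lookup (toggle A (P j)) (P j) ≡ true
    P-in-square = toggle-isFilter-upper (toggle A (P j)) (square-isFilter j eq c≢P)
                    (trans (lookup-toggle-≢ A c≢P) (lookup-bottom-free ℓ eq)) cv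
    P-out-square : lookup (toggle A (P j)) (P j) ≡ false
    P-out-square = trans (lookup-toggle A (P j)) (cong not (∈-inside ℓ (bottom-∈ ℓ) P-in))

  neighbour-free : ∀ j → lookup ℓ (P j) ≡ free
  neighbour-free j with lookup ℓ (P j) in eq
  ... | free    = refl
  ... | outside = contradiction eq (neighbour-not-outside j)
  ... | inside  = contradiction (lower-covers-outside j eq) (proj₂ (proj₂ valid) (P j) eq _)

  k′≤dim : k′ ≤ dim ℓ
  k′≤dim = injective⇒≤ {f = λ j → freeIndex ℓ (P j) (neighbour-free j)}
    λ {i} {j} e → P-injective i j (freeIndex-injective ℓ _ _ _ _ e)

cubeOf-isMaxCube : ∀ (ℓ : Labelling n) → Valid ℓ → IsMaxCube n (dim ℓ) (cubeOf ℓ)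
cubeOf-isMaxCube ℓ valid = cubeOf-isInducedCube ℓ (proj₁ valid) ,
  λ k′ W′ dim<k′ cube′ ⊆W′ → <⇒≱ dim<k′ (LargerCube.k′≤dim ℓ valid cube′ ⊆W′)

cubeOf-filters⇒compatible : ∀ (ℓ : Labelling n) → (∀ S → S ∈ᵛ cubeOf ℓ → IsFilter n S) →
                            Compatible (CovF n) ℓ
cubeOf-filters⇒compatible ℓ filters a b c with lookup ℓ b ≟ˡ inside | lookup ℓ a in ea
... | yes b-in    | _       = inj₁ b-in
... | no  _       | outside = inj₂ refl
... | no  b-not-in | inside  = contradiction
  (lookup-bottom-true ℓ (filters _ (bottom-∈ ℓ) a b (c ◅ ε) (∈-inside ℓ (bottom-∈ ℓ) ea))) b-not-in
... | no  b-not-in | free    = contradiction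
  (lookup-bottom-true ℓ (trans (sym (lookup-toggle-≢ (bottom ℓ) (CovF-irreflexive c ∘′ sym)))
                               (filters S S∈ a b (c ◅ ε) a∈S))) b-not-in
  where
  S : Sub _
  S = toggle (bottom ℓ) a
  S∈ : S ∈ᵛ cubeOf ℓ
  S∈ = subst (_∈ᵛ cubeOf ℓ) (fill-toggle-free ℓ _ a ea) (fill-∈ ℓ _)
  a∈S : lookup S a ≡ true
  a∈S = trans (lookup-toggle (bottom ℓ) a) (cong not (lookup-bottom-free ℓ ea))

freeAt : Labelling n → Fin n → Labelling n
freeAt ℓ a = ℓ [ a ]≔ free

dim-freeAt : ∀ (ℓ : Labelling n) a → lookup ℓ a ≢ free → dim (freeAt ℓ a) ≡ suc (dim ℓ)
dim-freeAt (inside ∷ ℓ)  zero    _ = refl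
dim-freeAt (outside ∷ ℓ) zero    _ = refl
dim-freeAt (free ∷ ℓ)    zero    a-not-free = contradiction refl a-not-free
dim-freeAt (inside ∷ ℓ)  (suc a) a-not-free = dim-freeAt ℓ a a-not-free
dim-freeAt (outside ∷ ℓ) (suc a) a-not-free = dim-freeAt ℓ a a-not-free
dim-freeAt (free ∷ ℓ)    (suc a) a-not-free = cong suc (dim-freeAt ℓ a a-not-free)

cubeOf-⊆-freeAt : ∀ (ℓ : Labelling n) a → cubeOf ℓ ⊆ᵛ cubeOf (freeAt ℓ a)
cubeOf-⊆-freeAt ℓ a S S∈ = ∈-cubeOf⁺ (freeAt ℓ a) S fits-at
  where
  fits-at : ∀ i → fits (lookup (freeAt ℓ a) i) (lookup S i) ≡ true
  fits-at i with i ≟ᶠ a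
  ... | yes refl = cong (λ l → fits l (lookup S a)) (lookup∘updateAt a ℓ)
  ... | no  i≢a  =
    trans (cong (λ l → fits l (lookup S i)) (lookup∘updateAt′ i a i≢a ℓ)) (∈-cubeOf⁻ ℓ S S∈ i)

compatible-freeAt : ∀ (ℓ : Labelling n) a → Compatible (CovF n) ℓ →
                    (∀ c → CovF n c a → lookup ℓ c ≡ outside) →
                    (∀ b → CovF n a b → lookup ℓ b ≡ inside) → Compatible (CovF n) (freeAt ℓ a)
compatible-freeAt ℓ a compat lower upper x y c with y ≟ᶠ a | x ≟ᶠ a
... | yes refl | _        = inj₂ (trans (lookup∘updateAt′ x a (CovF-irreflexive c) ℓ) (lower x c))
... | no  y≢a  | yes refl = inj₁ (trans (lookup∘updateAt′ y a y≢a ℓ) (upper y c))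
... | no  y≢a  | no  x≢a  = subst₂ (λ l l′ → l′ ≡ inside ⊎ l ≡ outside)
                               (sym (lookup∘updateAt′ x a x≢a ℓ)) (sym (lookup∘updateAt′ y a y≢a ℓ))
                               (compat x y c)

fixedLabel : Bool → Label
fixedLabel true  = inside
fixedLabel false = outside

fits-fixedLabel : ∀ b x → fits (fixedLabel b) x ≡ true → x ≡ b
fits-fixedLabel true  true  _ = refl
fits-fixedLabel false false _ = refl

fixedLabel-fits : ∀ b → fits (fixedLabel b) b ≡ true
fixedLabel-fits true  = refl
fixedLabel-fits false = refl

module CubeLabelling {W : VSet n} (cube : IsInducedCube n k W) where

  open InducedCube cube

  A₀ : Sub n
  A₀ = f (replicate k false)

  Direction : Fin n → Set
  Direction i = ∃[ j ] direction j ≡ i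

  labelAt : ∀ i → Dec (Direction i) → Label
  labelAt i (yes _) = free
  labelAt i (no _)  = fixedLabel (lookup A₀ i)

  direction? : ∀ i → Dec (Direction i)
  direction? i = any? λ j → direction j ≟ᶠ i

  ℓ : Labelling n
  ℓ = tabulate λ i → labelAt i (direction? i)

  lookup-ℓ : ∀ i → lookup ℓ i ≡ labelAt i (direction? i)
  lookup-ℓ i = lookup∘tabulate _ i

  ℓ-direction : ∀ j → lookup ℓ (direction j) ≡ free
  ℓ-direction j with direction? (direction j) | lookup-ℓ (direction j)
  ... | yes _   | e = e
  ... | no  ¬dj | _ = contradiction (j , refl) ¬dj

  lookup-f-fixed : ∀ u i → ¬ Direction i → lookup (f u) i ≡ lookup A₀ i
  lookup-f-fixed u i ¬di = toggle-induction (λ u → lookup (f u) i ≡ lookup A₀ i) refl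
    (λ u j IH → trans (cong (λ S → lookup S i) (f-toggle u j))
                      (trans (lookup-toggle-≢ (f u) λ e → ¬di (j , sym e)) IH)) u

  lookup-f-direction : ∀ u j → lookup (f u) (direction j) ≡ lookup u j xor lookup A₀ (direction j)
  lookup-f-direction = toggle-induction
    (λ u → ∀ j → lookup (f u) (direction j) ≡ lookup u j xor lookup A₀ (direction j))
    (λ j → cong (_xor lookup A₀ (direction j)) (sym (lookup-replicate j false))) step
    where
    step : ∀ u i → (∀ j → lookup (f u) (direction j) ≡ lookup u j xor lookup A₀ (direction j)) →
           ∀ j → lookup (f (toggle u i)) (direction j) ≡ lookup (toggle u i) j xor lookup A₀ (direction j)
    step u i IH j with j ≟ᶠ i
    ... | yes refl = begin
      lookup (f (toggle u j)) (direction j)             ≡⟨ cong (λ S → lookup S (direction j)) (f-toggle u j) ⟩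
      lookup (toggle (f u) (direction j)) (direction j) ≡⟨ lookup-toggle (f u) (direction j) ⟩
      not (lookup (f u) (direction j))                  ≡⟨ cong not (IH j) ⟩
      not (lookup u j xor a)                            ≡⟨ not-distribˡ-xor (lookup u j) a ⟩
      not (lookup u j) xor a                            ≡⟨ cong (_xor a) (sym (lookup-toggle u j)) ⟩
      lookup (toggle u j) j xor a                       ∎
      where
      a : Bool
      a = lookup A₀ (direction j)
    ... | no  j≢i  = trans (cong (λ S → lookup S (direction j)) (f-toggle u i))
                       (trans (lookup-toggle-≢ (f u) (j≢i ∘′ direction-injective j i))
                         (trans (IH j) (cong (_xor lookup A₀ (direction j)) (sym (lookup-toggle-≢ u j≢i)))))

  W⊆cubeOf : W ⊆ᵛ cubeOf ℓ
  W⊆cubeOf S S∈W with f-onto S S∈W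
  ... | u , refl = ∈-cubeOf⁺ ℓ (f u) fits-at
    where
    fits-at : ∀ i → fits (lookup ℓ i) (lookup (f u) i) ≡ true
    fits-at i with direction? i | lookup-ℓ i
    ... | yes _   | e = cong (λ l → fits l (lookup (f u) i)) e
    ... | no  ¬di | e = trans (cong (λ l → fits l (lookup (f u) i)) e)
                              (subst (λ x → fits (fixedLabel (lookup A₀ i)) x ≡ true)
                                     (sym (lookup-f-fixed u i ¬di)) (fixedLabel-fits (lookup A₀ i)))

  cubeOf⊆W : cubeOf ℓ ⊆ᵛ W
  cubeOf⊆W S S∈ = subst (_∈ᵛ W) (lookup-ext (f u) S agree) (f∈W u)
    where
    u : Vec Bool k
    u = tabulate λ j → lookup S (direction j) xor lookup A₀ (direction j)
    agree : ∀ i → lookup (f u) i ≡ lookup S i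
    agree i with direction? i | lookup-ℓ i
    ... | yes (j , refl) | _ = begin
      lookup (f u) (direction j) ≡⟨ lookup-f-direction u j ⟩
      lookup u j xor a           ≡⟨ cong (_xor a) (lookup∘tabulate _ j) ⟩
      (x xor a) xor a            ≡⟨ xor-assoc x a a ⟩
      x xor (a xor a)            ≡⟨ cong (x xor_) (xor-same a) ⟩
      x xor false                ≡⟨ xor-identityʳ x ⟩
      x                          ∎
      where
      x a : Bool
      x = lookup S (direction j)
      a = lookup A₀ (direction j)
    ... | no ¬di | e = trans (lookup-f-fixed u i ¬di)
      (sym (fits-fixedLabel (lookup A₀ i) (lookup S i)
             (subst (λ l → fits l (lookup S i) ≡ true) e (∈-cubeOf⁻ ℓ S S∈ i))))

  W≐cubeOf : W ≐ cubeOf ℓ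
  W≐cubeOf S with W S in eq | cubeOf ℓ S in eq′
  ... | true  | true  = refl
  ... | false | false = refl
  ... | true  | false = trans (sym (W⊆cubeOf S eq)) eq′
  ... | false | true  = trans (sym eq) (cubeOf⊆W S eq′)

  k≤dim : k ≤ dim ℓ
  k≤dim = injective⇒≤ {f = λ j → freeIndex ℓ (direction j) (ℓ-direction j)}
    λ {i} {j} e → direction-injective i j (freeIndex-injective ℓ _ _ _ _ e)

isMaxCube⇒cubeOf : ∀ {W : VSet n} → IsMaxCube n k W →
                   Σ[ ℓ ∈ Labelling n ] Valid ℓ × dim ℓ ≡ k × W ≐ cubeOf ℓ
isMaxCube⇒cubeOf {n} {k} {W} (cube , maximal) =
  ℓ , (compat , outside-saturated , inside-saturated) , dim≡k , W≐cubeOf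
  where
  open CubeLabelling cube

  compat : Compatible (CovF n) ℓ
  compat = cubeOf-filters⇒compatible ℓ λ S S∈ → InducedCube.W-filters cube S (cubeOf⊆W S S∈)

  no-larger : ∀ ℓ′ → Compatible (CovF n) ℓ′ → k < dim ℓ′ → ¬ (cubeOf ℓ ⊆ᵛ cubeOf ℓ′)
  no-larger ℓ′ compat′ k<dim ⊆ℓ′ =
    maximal (dim ℓ′) (cubeOf ℓ′) k<dim (cubeOf-isInducedCube ℓ′ compat′)
            λ S S∈ → ⊆ℓ′ S (W⊆cubeOf S S∈)

  dim≡k : dim ℓ ≡ k
  dim≡k = ≤-antisym (≮⇒≥ λ k<dim → no-larger ℓ compat k<dim λ S S∈ → S∈) k≤dim

  not-extendable : ∀ a → lookup ℓ a ≢ free → (∀ c → CovF n c a → lookup ℓ c ≡ outside) →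
                   ¬ (∀ b → CovF n a b → lookup ℓ b ≡ inside)
  not-extendable a a-not-free lower upper = no-larger (freeAt ℓ a)
    (compatible-freeAt ℓ a compat lower upper)
    (subst (k <_) (sym (trans (dim-freeAt ℓ a a-not-free) (cong suc dim≡k))) (n<1+n k))
    (cubeOf-⊆-freeAt ℓ a)

  outside-saturated : ∀ a → lookup ℓ a ≡ outside → ⊤ → ¬ (∀ b → CovF n a b → lookup ℓ b ≡ inside)
  outside-saturated a a-out _ = not-extendable a (λ e → case trans (sym a-out) e of λ ()) lower
    where
    lower : ∀ c → CovF n c a → lookup ℓ c ≡ outside
    lower c cv with compat c a cv
    ... | inj₁ a-in  = case trans (sym a-out) a-in of λ ()
    ... | inj₂ c-out = c-out

  inside-saturated : ∀ a → lookup ℓ a ≡ inside → ⊤ → ¬ (∀ c → CovF n c a → lookup ℓ c ≡ outside)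
  inside-saturated a a-in _ lower = not-extendable a (λ e → case trans (sym a-in) e of λ ()) lower upper
    where
    upper : ∀ b → CovF n a b → lookup ℓ b ≡ inside
    upper b cv with compat a b cv
    ... | inj₁ b-in  = b-in
    ... | inj₂ a-out = case trans (sym a-in) a-out of λ ()

cubeOf-injective : ∀ (ℓ ℓ′ : Labelling n) → cubeOf ℓ ≐ cubeOf ℓ′ → ℓ ≡ ℓ′
cubeOf-injective ℓ ℓ′ same = lookup-ext ℓ ℓ′ label-eq
  where
  to : ∀ {S} → S ∈ᵛ cubeOf ℓ → S ∈ᵛ cubeOf ℓ′
  to {S} S∈ = trans (sym (same S)) S∈
  from : ∀ {S} → S ∈ᵛ cubeOf ℓ′ → S ∈ᵛ cubeOf ℓ
  from {S} S∈ = trans (same S) S∈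
  clash : ∀ {b} {A : Set} → b ≡ true → b ≡ false → A
  clash refl ()
  label-eq : ∀ i → lookup ℓ i ≡ lookup ℓ′ i
  label-eq i with lookup ℓ i in e | lookup ℓ′ i in e′
  ... | inside  | inside  = refl
  ... | free    | free    = refl
  ... | outside | outside = refl
  ... | inside  | free    = clash (∈-inside ℓ (from (bottom-∈ ℓ′)) e) (lookup-bottom-free ℓ′ e′)
  ... | inside  | outside = clash (∈-inside ℓ (bottom-∈ ℓ) e) (∈-outside ℓ′ (to (bottom-∈ ℓ)) e′)
  ... | free    | inside  = clash (∈-inside ℓ′ (to (bottom-∈ ℓ)) e′) (lookup-bottom-free ℓ e)
  ... | free    | outside = clash (lookup-top-free ℓ e) (∈-outside ℓ′ (to (top-∈ ℓ)) e′)
  ... | outside | inside  = clash (∈-inside ℓ′ (bottom-∈ ℓ′) e′) (∈-outside ℓ (from (bottom-∈ ℓ′)) e)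
  ... | outside | free    = clash (lookup-top-free ℓ′ e′) (∈-outside ℓ (from (top-∈ ℓ′)) e)

-- Counting labellings

satisfying : (Labelling n → Bool) → List (Labelling n)
satisfying {zero}  q = if q [] then [] ∷ [] else []
satisfying {suc n} q =
  map (inside ∷_) (satisfying (q ∘ (inside ∷_))) ++
  map (free ∷_) (satisfying (q ∘ (free ∷_))) ++
  map (outside ∷_) (satisfying (q ∘ (outside ∷_)))

count : (Labelling n → Bool) → ℕ
count q = length (satisfying q)

count-suc : ∀ (q : Labelling (suc n) → Bool) →
            count q ≡ count (q ∘ (inside ∷_)) + (count (q ∘ (free ∷_)) + count (q ∘ (outside ∷_)))
count-suc q =
  trans (length-++ (map (inside ∷_) ins))
        (cong₂ _+_ (length-map _ ins)
               (trans (length-++ (map (free ∷_) frees)) (cong₂ _+_ (length-map _ frees) (length-map _ outs))))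
  where
  ins frees outs : List (Labelling _)
  ins   = satisfying (q ∘ (inside ∷_))
  frees = satisfying (q ∘ (free ∷_))
  outs  = satisfying (q ∘ (outside ∷_))

count-false : ∀ (q : Labelling n → Bool) → (∀ ℓ → q ℓ ≡ false) → count q ≡ 0
count-false {zero}  q never rewrite never [] = refl
count-false {suc n} q never =
  trans (count-suc q) (cong₂ _+_ (zero-at inside) (cong₂ _+_ (zero-at free) (zero-at outside)))
  where
  zero-at : ∀ l → count (q ∘ (l ∷_)) ≡ 0
  zero-at l = count-false (q ∘ (l ∷_)) (never ∘ (l ∷_))

satisfying-sound : ∀ (q : Labelling n → Bool) → All (T ∘ q) (satisfying q)
satisfying-sound {zero}  q = base (q []) refl
  where
  base : ∀ b → q [] ≡ b → All (T ∘ q) (if b then [] ∷ [] else [])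
  base true  e = subst T (sym e) _ ∷ []
  base false _ = []
satisfying-sound {suc n} q = Allₚ.++⁺ (extend inside) (Allₚ.++⁺ (extend free) (extend outside))
  where
  extend : ∀ l → All (T ∘ q) (map (l ∷_) (satisfying (q ∘ (l ∷_))))
  extend l = Allₚ.map⁺ (satisfying-sound (q ∘ (l ∷_)))

satisfying-complete : ∀ (q : Labelling n → Bool) ℓ → T (q ℓ) → ℓ ∈ satisfying q
satisfying-complete {zero}  q [] t = base (q []) t
  where
  base : ∀ b → T b → [] ∈ (if b then [] ∷ [] else [])
  base true _ = here refl
satisfying-complete {suc n} q (l ∷ ℓ) t =
  placed l (Anyₚ.map⁺ (Any.map (cong (l ∷_)) (satisfying-complete (q ∘ (l ∷_)) ℓ t)))
  where
  sols : Label → List (Labelling n)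
  sols l = satisfying (q ∘ (l ∷_))
  placed : ∀ l {x} → x ∈ map (l ∷_) (sols l) → x ∈ satisfying q
  placed inside  x∈ = Anyₚ.++⁺ˡ x∈
  placed free    x∈ = Anyₚ.++⁺ʳ (map (inside ∷_) (sols inside)) (Anyₚ.++⁺ˡ x∈)
  placed outside x∈ = Anyₚ.++⁺ʳ (map (inside ∷_) (sols inside)) (Anyₚ.++⁺ʳ (map (free ∷_) (sols free)) x∈)

satisfying-unique : ∀ (q : Labelling n → Bool) → AllPairs _≢_ (satisfying q)
satisfying-unique {zero}  q = base (q [])
  where
  base : ∀ b → AllPairs _≢_ (if b then [] ∷ [] else [])
  base true  = [] ∷ []
  base false = []
satisfying-unique {suc n} q =
  AllPairsₚ.++⁺ (extend inside) (AllPairsₚ.++⁺ (extend free) (extend outside) (apart (λ ())))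
                (apart (λ ()) ++ᴬ apart (λ ()))
  where
  sols : Label → List (Labelling n)
  sols l = satisfying (q ∘ (l ∷_))
  extend : ∀ l → AllPairs _≢_ (map (l ∷_) (sols l))
  extend l = AllPairsₚ.map⁺ (AllPairs.map (λ ℓ≢ℓ′ → ℓ≢ℓ′ ∘ ∷-injectiveʳ)
                                          (satisfying-unique (q ∘ (l ∷_))))
  apart : ∀ {l l′} → l ≢ l′ → All (λ x → All (x ≢_) (map (l′ ∷_) (sols l′))) (map (l ∷_) (sols l))
  apart l≢l′ =
    Allₚ.map⁺ (All.universal (λ _ → Allₚ.map⁺ (All.universal (λ _ e → l≢l′ (∷-injectiveˡ e)) _)) _)
  _++ᴬ_ : ∀ {xs ys zs : List (Labelling (suc n))} →
          All (λ x → All (x ≢_) ys) xs → All (λ x → All (x ≢_) zs) xs →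
          All (λ x → All (x ≢_) (ys ++ zs)) xs
  a ++ᴬ b = All.zipWith (λ (p , q) → Allₚ.++⁺ p q) (a , b)

maxCubes-count : ∀ (q : Labelling n → Bool) → (∀ ℓ → T (q ℓ) ⇔ (Valid ℓ × dim ℓ ≡ k)) → h≡ n k (count q)
maxCubes-count {n} {k} q q⇔ =
  map cubeOf (satisfying q) , length-map cubeOf (satisfying q) , distinct , maximal , complete
  where
  distinct : AllPairs (λ W W′ → ¬ (W ≐ W′)) (map cubeOf (satisfying q))
  distinct =
    AllPairsₚ.map⁺ (AllPairs.map (λ ℓ≢ℓ′ same → ℓ≢ℓ′ (cubeOf-injective _ _ same)) (satisfying-unique q))
  maximal : All (IsMaxCube n k) (map cubeOf (satisfying q))
  maximal = Allₚ.map⁺ (All.map (λ {ℓ} t → let (valid , dim≡) = Equivalence.to (q⇔ ℓ) t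
                                          in subst (λ j → IsMaxCube n j (cubeOf ℓ)) dim≡ (cubeOf-isMaxCube ℓ valid))
                               (satisfying-sound q))
  complete : ∀ W → IsMaxCube n k W → Any (W ≐_) (map cubeOf (satisfying q))
  complete W max-cube with isMaxCube⇒cubeOf max-cube
  ... | ℓ , valid , dim≡ , W≐ = Anyₚ.map⁺ (Any.map (λ { refl → W≐ })
          (satisfying-complete q ℓ (Equivalence.from (q⇔ ℓ) (valid , dim≡))))

-- Removing the first element of a labelled poset

module Peel (R : Fin (suc m) → Fin (suc m) → Set) (U D : Fin (suc m) → Set) (l : Label) (τ : Labelling m) where

  R′ : Fin m → Fin m → Set
  R′ a b = R (suc a) (suc b)

  U′ D′ : Fin m → Set
  U′ a = U (suc a) × (R (suc a) zero → l ≡ inside)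
  D′ a = D (suc a) × (R zero (suc a) → l ≡ outside)

  HeadConditions : Set
  HeadConditions =
    (R zero zero → l ≡ inside ⊎ l ≡ outside) ×
    (∀ b → R zero (suc b) → lookup τ b ≡ inside ⊎ l ≡ outside) ×
    (∀ b → R (suc b) zero → l ≡ inside ⊎ lookup τ b ≡ outside) ×
    (l ≡ outside → U zero → ¬ ((R zero zero → l ≡ inside) × (∀ b → R zero (suc b) → lookup τ b ≡ inside))) ×
    (l ≡ inside → D zero → ¬ ((R zero zero → l ≡ outside) × (∀ c → R (suc c) zero → lookup τ c ≡ outside)))

  peel : Admissible R U D (l ∷ τ) ⇔ (HeadConditions × Admissible R′ U′ D′ τ)
  peel = mk⇔ to from
    where
    allOf : ∀ {P : Fin (suc m) → Set} {x} → (P zero → l ≡ x) → (∀ b → P (suc b) → lookup τ b ≡ x) →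
            ∀ b → P b → lookup (l ∷ τ) b ≡ x
    allOf h₀ hₛ zero    = h₀
    allOf h₀ hₛ (suc b) = hₛ b
    to : Admissible R U D (l ∷ τ) → HeadConditions × Admissible R′ U′ D′ τ
    to (compat , out-sat , in-sat) =
      (compat zero zero , compat zero ∘ suc , (λ b → compat (suc b) zero) ,
       (λ l-out u (h₀ , hₛ) → out-sat zero l-out u (allOf h₀ hₛ)) ,
       (λ l-in d (h₀ , hₛ) → in-sat zero l-in d (allOf h₀ hₛ))) ,
      (λ a b → compat (suc a) (suc b)) ,
      (λ a a-out (u , h₀) hₛ → out-sat (suc a) a-out u (allOf h₀ hₛ)) ,
      (λ a a-in (d , h₀) hₛ → in-sat (suc a) a-in d (allOf h₀ hₛ))
    from : HeadConditions × Admissible R′ U′ D′ τ → Admissible R U D (l ∷ τ)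
    from ((c₀₀ , c₀ₛ , cₛ₀ , out₀ , in₀) , (compat′ , out-sat′ , in-sat′)) = compat , out-sat , in-sat
      where
      compat : Compatible R (l ∷ τ)
      compat zero    zero    = c₀₀
      compat zero    (suc b) = c₀ₛ b
      compat (suc a) zero    = cₛ₀ a
      compat (suc a) (suc b) = compat′ a b
      out-sat : ∀ a → lookup (l ∷ τ) a ≡ outside → U a → ¬ (∀ b → R a b → lookup (l ∷ τ) b ≡ inside)
      out-sat zero    a-out u all = out₀ a-out u (all zero , all ∘ suc)
      out-sat (suc a) a-out u all = out-sat′ a a-out (u , all zero) (all ∘ suc)
      in-sat : ∀ a → lookup (l ∷ τ) a ≡ inside → D a → ¬ (∀ c → R c a → lookup (l ∷ τ) c ≡ outside)
      in-sat zero    a-in d all = in₀ a-in d (all zero , all ∘ suc)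
      in-sat (suc a) a-in d all = in-sat′ a a-in (d , all zero) (all ∘ suc)

admissible-cong : ∀ {R R′ : Fin m → Fin m → Set} {U U′ D D′ : Fin m → Set} →
  (∀ a b → R a b ⇔ R′ a b) → (∀ a → U a ⇔ U′ a) → (∀ a → D a ⇔ D′ a) →
  ∀ ℓ → Admissible R U D ℓ ⇔ Admissible R′ U′ D′ ℓ
admissible-cong hR hU hD ℓ =
  mk⇔ (transport hR hU hD)
      (transport (λ a b → ⇔-sym (hR a b)) (λ a → ⇔-sym (hU a)) (λ a → ⇔-sym (hD a)))
  where
  transport : ∀ {R R′ : Fin _ → Fin _ → Set} {U U′ D D′ : Fin _ → Set} →
    (∀ a b → R a b ⇔ R′ a b) → (∀ a → U a ⇔ U′ a) → (∀ a → D a ⇔ D′ a) →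
    Admissible R U D ℓ → Admissible R′ U′ D′ ℓ
  transport hR hU hD (compat , out-sat , in-sat) =
    (λ a b r → compat a b (Equivalence.from (hR a b) r)) ,
    (λ a a-out u all → out-sat a a-out (Equivalence.from (hU a) u) λ b r → all b (Equivalence.to (hR a b) r)) ,
    (λ a a-in d all → in-sat a a-in (Equivalence.from (hD a) d) λ c r → all c (Equivalence.to (hR c a) r))

-- Zigzag fences

data Parity : Set where
  peak valley : Parity

opposite : Parity → Parity
opposite peak   = valley
opposite valley = peak

-- ZigzagCov p i j: i is covered by j in the infinite zigzag fence whose element 0 has parity p.
data ZigzagCov : Parity → ℕ → ℕ → Set where
  peak-cov   : ZigzagCov peak 1 0
  valley-cov : ZigzagCov valley 0 1
  shift      : ∀ {p i j} → ZigzagCov (opposite p) i j → ZigzagCov p (suc i) (suc j)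

Zigzag : Parity → Fin m → Fin m → Set
Zigzag p a b = ZigzagCov p (toℕ a) (toℕ b)

-- A saturation condition at element 0 of a fence is imposed only when its neighbour
-- outside the fence does not already provide it.
ImposedAt0 : Bool → Fin m → Set
ImposedAt0 c a = toℕ a ≡ 0 → T c

upwardImposed downwardImposed : Parity → Bool → Fin m → Set
upwardImposed peak     _ = ImposedAt0 true
upwardImposed valley   c = ImposedAt0 c
downwardImposed peak   c = ImposedAt0 c
downwardImposed valley _ = ImposedAt0 true

ZigzagAdmissible : Parity → Bool → Labelling m → Set
ZigzagAdmissible p c = Admissible (Zigzag p) (upwardImposed p c) (downwardImposed p c)

first : Labelling m → Maybe Label
first []      = nothing
first (x ∷ _) = just x

AllFirst AnyFirst : (Label → Set) → Maybe Label → Set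
AllFirst P nothing  = ⊤
AllFirst P (just x) = P x
AnyFirst P nothing  = ⊥
AnyFirst P (just x) = P x

allFirst? : {P : Label → Set} → (∀ x → Dec (P x)) → ∀ h → Dec (AllFirst P h)
allFirst? P? nothing  = yes tt
allFirst? P? (just x) = P? x

anyFirst? : {P : Label → Set} → (∀ x → Dec (P x)) → ∀ h → Dec (AnyFirst P h)
anyFirst? P? nothing  = no λ ()
anyFirst? P? (just x) = P? x

AllFirst-lookup : ∀ {P : Label → Set} (τ : Labelling m) →
                  (∀ b → toℕ b ≡ 0 → P (lookup τ b)) ⇔ AllFirst P (first τ)
AllFirst-lookup []      = mk⇔ (λ _ → tt) λ _ ()
AllFirst-lookup (x ∷ τ) = mk⇔ (λ h → h zero refl) λ { px zero _ → px }

ZigzagCov-shift : ∀ {p i j} → ZigzagCov p (suc i) (suc j) ⇔ ZigzagCov (opposite p) i j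
ZigzagCov-shift = mk⇔ (λ { (shift c) → c }) shift

ZigzagCov-peak-down : ∀ {j} → ZigzagCov peak (suc j) 0 ⇔ j ≡ 0
ZigzagCov-peak-down = mk⇔ (λ { peak-cov → refl }) λ { refl → peak-cov }

ZigzagCov-valley-up : ∀ {j} → ZigzagCov valley 0 (suc j) ⇔ j ≡ 0
ZigzagCov-valley-up = mk⇔ (λ { valley-cov → refl }) λ { refl → valley-cov }

-- What the peeled head conditions say for element 0 of a zigzag fence.
LocalConditions : Parity → Bool → Label → Maybe Label → Set
LocalConditions peak c l h =
  AllFirst (λ x → l ≡ inside ⊎ x ≡ outside) h × l ≢ outside ×
  (l ≡ inside → T c → ¬ AllFirst (_≡ outside) h)
LocalConditions valley c l h =
  AllFirst (λ x → x ≡ inside ⊎ l ≡ outside) h × l ≢ inside ×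
  (l ≡ outside → T c → ¬ AllFirst (_≡ inside) h)

zigzag-headConditions : ∀ p c l (τ : Labelling m) →
  Peel.HeadConditions (Zigzag p) (upwardImposed p c) (downwardImposed p c) l τ ⇔ LocalConditions p c l (first τ)
zigzag-headConditions peak c l τ = mk⇔
  (λ (_ , _ , c-down , out₀ , in₀) →
     Equivalence.to (AllFirst-lookup τ) (λ b b≡0 → c-down b (Equivalence.from ZigzagCov-peak-down b≡0)) ,
     (λ l-out → out₀ l-out (λ _ → tt) ((λ ()) , λ _ ())) ,
     (λ l-in t all-out → in₀ l-in (λ _ → t)
        ((λ ()) , λ b cv → Equivalence.from (AllFirst-lookup τ) all-out b (Equivalence.to ZigzagCov-peak-down cv))))
  (λ (c-down , l-not-out , in-cond) →
     (λ ()) , (λ _ ()) ,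
     (λ b cv → Equivalence.from (AllFirst-lookup τ) c-down b (Equivalence.to ZigzagCov-peak-down cv)) ,
     (λ l-out _ _ → l-not-out l-out) ,
     (λ l-in d (_ , all-out) → in-cond l-in (d refl)
        (Equivalence.to (AllFirst-lookup τ) λ b b≡0 → all-out b (Equivalence.from ZigzagCov-peak-down b≡0))))
zigzag-headConditions valley c l τ = mk⇔
  (λ (_ , c-up , _ , out₀ , in₀) →
     Equivalence.to (AllFirst-lookup τ) (λ b b≡0 → c-up b (Equivalence.from ZigzagCov-valley-up b≡0)) ,
     (λ l-in → in₀ l-in (λ _ → tt) ((λ ()) , λ _ ())) ,
     (λ l-out t all-in → out₀ l-out (λ _ → t)
        ((λ ()) , λ b cv → Equivalence.from (AllFirst-lookup τ) all-in b (Equivalence.to ZigzagCov-valley-up cv))))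
  (λ (c-up , l-not-in , out-cond) →
     (λ ()) ,
     (λ b cv → Equivalence.from (AllFirst-lookup τ) c-up b (Equivalence.to ZigzagCov-valley-up cv)) ,
     (λ _ ()) ,
     (λ l-out u (_ , all-in) → out-cond l-out (u refl)
        (Equivalence.to (AllFirst-lookup τ) λ b b≡0 → all-in b (Equivalence.from ZigzagCov-valley-up b≡0))) ,
     (λ l-in _ _ → l-not-in l-in))

extreme : Parity → Label
extreme peak   = inside
extreme valley = outside

isExtreme : Parity → Label → Bool
isExtreme p l = isYes (l ≟ˡ extreme p)

isFree : Label → Bool
isFree l = isYes (l ≟ˡ free)

-- The state describes the element just read: free, fixed with a free neighbour already,
-- or fixed and still waiting for a free neighbour.
data State : Set where
  afterFree dominated undominated : State

fixedBefore : State → Bool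
fixedBefore afterFree = false
fixedBefore _         = true

next : State → Label → State
next _           free = afterFree
next afterFree   _    = dominated
next dominated   _    = undominated
next undominated _    = undominated

allowed : Parity → State → Label → Bool
allowed p afterFree   l = isExtreme p l
allowed p dominated   l = not (isExtreme (opposite p) l)
allowed p undominated l = isFree l

accepting : State → Bool
accepting undominated = false
accepting _           = true

accepts : Parity → State → Labelling m → Bool
accepts p s []      = accepting s
accepts p s (l ∷ τ) = allowed p s l ∧ accepts (opposite p) (next s l) τ

-- What the state demands of the next label; part of the invariant of zigzag⇔accepts.
Pending : Parity → State → Maybe Label → Set
Pending p afterFree   h = AllFirst (_≡ extreme p) h
Pending p dominated   h = ⊤
Pending p undominated h = AnyFirst (_≢ extreme p) h

pending? : ∀ p s h → Dec (Pending p s h)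
pending? p afterFree   = allFirst? (_≟ˡ extreme p)
pending? p dominated   = λ _ → yes tt
pending? p undominated = anyFirst? (λ x → ¬? (x ≟ˡ extreme p))

local? : ∀ p c l h → Dec (LocalConditions p c l h)
local? peak c l h =
  allFirst? (λ x → (l ≟ˡ inside) ⊎-dec (x ≟ˡ outside)) h ×-dec ¬? (l ≟ˡ outside) ×-dec
  ((l ≟ˡ inside) →-dec (T? c →-dec ¬? (allFirst? (_≟ˡ outside) h)))
local? valley c l h =
  allFirst? (λ x → (x ≟ˡ inside) ⊎-dec (l ≟ˡ outside)) h ×-dec ¬? (l ≟ˡ inside) ×-dec
  ((l ≟ˡ outside) →-dec (T? c →-dec ¬? (allFirst? (_≟ˡ inside) h)))

∀-dec : {A : Set} (xs : List A) → (∀ x → x ∈ xs) →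
        {P : A → Set} → (∀ x → Dec (P x)) → Dec (∀ x → P x)
∀-dec xs complete P? =
  map′ (λ all x → All.lookup all (complete x)) (λ f → All.tabulate λ {x} _ → f x) (All.all? P? xs)

∀-parity? : {P : Parity → Set} → (∀ p → Dec (P p)) → Dec (∀ p → P p)
∀-parity? = ∀-dec (peak ∷ valley ∷ []) λ { peak → here refl ; valley → there (here refl) }

∀-state? : {P : State → Set} → (∀ s → Dec (P s)) → Dec (∀ s → P s)
∀-state? = ∀-dec (afterFree ∷ dominated ∷ undominated ∷ [])
            λ { afterFree → here refl ; dominated → there (here refl) ; undominated → there (there (here refl)) }

∀-label? : {P : Label → Set} → (∀ l → Dec (P l)) → Dec (∀ l → P l)
∀-label? = ∀-dec (inside ∷ free ∷ outside ∷ [])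
            λ { inside → here refl ; free → there (here refl) ; outside → there (there (here refl)) }

∀-first? : {P : Maybe Label → Set} → (∀ h → Dec (P h)) → Dec (∀ h → P h)
∀-first? = ∀-dec (nothing ∷ just inside ∷ just free ∷ just outside ∷ [])
            λ { nothing → here refl ; (just inside) → there (here refl)
              ; (just free) → there (there (here refl)) ; (just outside) → there (there (there (here refl))) }

dec-⇔ : {A B : Set} (a? : Dec A) (b? : Dec B) → does a? ≡ does b? → A ⇔ B
dec-⇔ (yes a) (yes b) _ = mk⇔ (λ _ → b) (λ _ → a)
dec-⇔ (no ¬a) (no ¬b) _ = mk⇔ (⊥-elim ∘ ¬a) (⊥-elim ∘ ¬b)

-- One transition of the automaton is exactly the peeled conditions at element 0; both sides
-- are decidable and agree on all 72 cases, which is checked by evaluation.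
step⇔ : ∀ p s l h → (Pending p s (just l) × LocalConditions p (fixedBefore s) l h) ⇔
                    (T (allowed p s l) × Pending (opposite p) (next s l) h)
step⇔ p s l h = dec-⇔ (before? p s l h) (after? p s l h) (table p s l h)
  where
  before? : ∀ p s l h → Dec (Pending p s (just l) × LocalConditions p (fixedBefore s) l h)
  before? p s l h = pending? p s (just l) ×-dec local? p (fixedBefore s) l h
  after? : ∀ p s l h → Dec (T (allowed p s l) × Pending (opposite p) (next s l) h)
  after? p s l h = T? (allowed p s l) ×-dec pending? (opposite p) (next s l) h
  table : ∀ p s l h → does (before? p s l h) ≡ does (after? p s l h)
  table = toWitness {a? = ∀-parity? λ p → ∀-state? λ s → ∀-label? λ l → ∀-first? λ h →
                           does (before? p s l h) ≟ᵇ does (after? p s l h)} tt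

T-isExtreme : ∀ {p l} → T (isExtreme p l) ⇔ l ≡ extreme p
T-isExtreme = mk⇔ toWitness fromWitness

imposedAt0-true : ∀ {A : Set} (a : Fin m) → A ⇔ ⊤ → A ⇔ ImposedAt0 true a
imposedAt0-true a A⇔⊤ = mk⇔ (λ _ _ → tt) (λ _ → Equivalence.from A⇔⊤ tt)

zigzag-tail : ∀ p c l (τ : Labelling m) →
  let open Peel (Zigzag p) (upwardImposed p c) (downwardImposed p c) l τ in
  Admissible R′ U′ D′ τ ⇔ ZigzagAdmissible (opposite p) (isExtreme p l) τ
zigzag-tail {m} p c l τ = admissible-cong (λ a b → ZigzagCov-shift) (up p) (down p) τ
  where
  up : ∀ p (a : Fin m) → (upwardImposed p c (suc a) × (Zigzag p (suc a) zero → l ≡ inside)) ⇔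
                           upwardImposed (opposite p) (isExtreme p l) a
  up peak a = mk⇔
    (λ (_ , h) a≡0 → Equivalence.from T-isExtreme (h (Equivalence.from ZigzagCov-peak-down a≡0)))
    (λ g → (λ ()) , λ cv → Equivalence.to T-isExtreme (g (Equivalence.to ZigzagCov-peak-down cv)))
  up valley a = imposedAt0-true a (mk⇔ (λ _ → tt) λ _ → (λ ()) , λ ())
  down : ∀ p (a : Fin m) → (downwardImposed p c (suc a) × (Zigzag p zero (suc a) → l ≡ outside)) ⇔
                             downwardImposed (opposite p) (isExtreme p l) a
  down peak a = imposedAt0-true a (mk⇔ (λ _ → tt) λ _ → (λ ()) , λ ())
  down valley a = mk⇔
    (λ (_ , h) a≡0 → Equivalence.from T-isExtreme (h (Equivalence.from ZigzagCov-valley-up a≡0)))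
    (λ g → (λ ()) , λ cv → Equivalence.to T-isExtreme (g (Equivalence.to ZigzagCov-valley-up cv)))

allowed⇒flag : ∀ p s l → T (allowed p s l) → isExtreme p l ≡ fixedBefore (next s l)
allowed⇒flag = toWitness {a? = ∀-parity? λ p → ∀-state? λ s → ∀-label? λ l →
  T? (allowed p s l) →-dec (isExtreme p l ≟ᵇ fixedBefore (next s l))} tt

admissible-[] : ∀ {R : Fin 0 → Fin 0 → Set} {U D : Fin 0 → Set} → Admissible R U D []
admissible-[] = (λ ()) , (λ ()) , (λ ())

zigzag⇔accepts : ∀ p s (τ : Labelling m) →
  (Pending p s (first τ) × ZigzagAdmissible p (fixedBefore s) τ) ⇔ T (accepts p s τ)
zigzag⇔accepts p afterFree   [] = mk⇔ (λ _ → tt) (λ _ → tt , admissible-[])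
zigzag⇔accepts p dominated   [] = mk⇔ (λ _ → tt) (λ _ → tt , admissible-[])
zigzag⇔accepts p undominated [] = mk⇔ (λ ()) (λ ())
zigzag⇔accepts p s (l ∷ τ) = mk⇔ to from
  where
  c : Bool
  c = fixedBefore s
  open Peel (Zigzag p) (upwardImposed p c) (downwardImposed p c) l τ using (peel)
  to : Pending p s (just l) × ZigzagAdmissible p c (l ∷ τ) → T (accepts p s (l ∷ τ))
  to (pending , admissible) =
    let (head , rest) = Equivalence.to peel admissible
        (allowed-l , pending′) = Equivalence.to (step⇔ p s l (first τ))
                                   (pending , Equivalence.to (zigzag-headConditions p c l τ) head)
        rest′ = subst (λ c′ → ZigzagAdmissible (opposite p) c′ τ) (allowed⇒flag p s l allowed-l)
                      (Equivalence.to (zigzag-tail p c l τ) rest)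
    in Equivalence.from T-∧
         (allowed-l , Equivalence.to (zigzag⇔accepts (opposite p) (next s l) τ) (pending′ , rest′))
  from : T (accepts p s (l ∷ τ)) → Pending p s (just l) × ZigzagAdmissible p c (l ∷ τ)
  from t =
    let (allowed-l , accepted) = Equivalence.to T-∧ t
        (pending′ , rest′) = Equivalence.from (zigzag⇔accepts (opposite p) (next s l) τ) accepted
        (pending , local) = Equivalence.from (step⇔ p s l (first τ)) (allowed-l , pending′)
        rest = subst (λ c′ → ZigzagAdmissible (opposite p) c′ τ) (sym (allowed⇒flag p s l allowed-l)) rest′
    in pending ,
       Equivalence.from peel (Equivalence.from (zigzag-headConditions p c l τ) local ,
                              Equivalence.from (zigzag-tail p c l τ) rest)

-- The S-fence

Cov-1-up : ∀ {j} → ¬ Cov 1 j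
Cov-1-up ()

Cov-2-up : ∀ {j} → Cov 2 (3 + j) ⇔ j ≡ 1
Cov-2-up = mk⇔ (λ { c24 → refl }) λ { refl → c24 }

Cov-3-up : ∀ {j} → ¬ Cov 3 (4 + j)
Cov-3-up ()

1<4 : 1 < 4
1<4 = s≤s (s≤s z≤n)

2<4 : 2 < 4
2<4 = s≤s (s≤s (s≤s z≤n))

3<4 : 3 < 4
3<4 = s≤s (s≤s (s≤s (s≤s z≤n)))

Cov-tail-to-head : ∀ {i j} → j < 4 → ¬ Cov (4 + i) j
Cov-tail-to-head (s≤s (s≤s (s≤s (s≤s ())))) c54
Cov-tail-to-head (s≤s (s≤s (s≤s (s≤s ())))) (cOdd₁ _)
Cov-tail-to-head (s≤s (s≤s (s≤s (s≤s ())))) (cOdd₂ _)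

Cov-shift : ∀ {i j} → Cov (4 + i) (4 + j) → Cov (6 + i) (6 + j)
Cov-shift c54        = cOdd₂ 0
Cov-shift (cOdd₁ k) = subst (λ x → Cov (5 + x) (6 + x)) (*-suc 2 k) (cOdd₁ (suc k))
Cov-shift (cOdd₂ k) = subst (λ x → Cov (7 + x) (6 + x)) (*-suc 2 k) (cOdd₂ (suc k))

mutual
  peakCov⇒Cov : ∀ {i j} → ZigzagCov peak i j → Cov (4 + i) (4 + j)
  peakCov⇒Cov peak-cov  = c54
  peakCov⇒Cov (shift c) = valleyCov⇒Cov c

  valleyCov⇒Cov : ∀ {i j} → ZigzagCov valley i j → Cov (5 + i) (5 + j)
  valleyCov⇒Cov valley-cov = cOdd₁ 0
  valleyCov⇒Cov (shift c)  = Cov-shift (peakCov⇒Cov c)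

Cov⇒peakCov : ∀ {i j} → Cov (4 + i) (4 + j) → ZigzagCov peak i j
Cov⇒peakCov c54        = peak-cov
Cov⇒peakCov (cOdd₁ k) = up k
  where
  up : ∀ k → ZigzagCov peak (1 + 2 * k) (2 + 2 * k)
  up zero    = shift valley-cov
  up (suc k) = subst (λ x → ZigzagCov peak (1 + x) (2 + x)) (sym (*-suc 2 k)) (shift (shift (up k)))
Cov⇒peakCov (cOdd₂ k) = down k
  where
  down : ∀ k → ZigzagCov peak (3 + 2 * k) (2 + 2 * k)
  down zero    = shift (shift peak-cov)
  down (suc k) = subst (λ x → ZigzagCov peak (3 + x) (2 + x)) (sym (*-suc 2 k)) (shift (shift (down k)))

Cov⇔peakCov : ∀ {i j} → Cov (4 + i) (4 + j) ⇔ ZigzagCov peak i j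
Cov⇔peakCov = mk⇔ Cov⇒peakCov peakCov⇒Cov

-- The conditions peeled off at x₁, x₂ and x₃, where h is the label of x₄ (if any).
FenceHead₁ : Label → Label → Set
FenceHead₁ l₁ l₂ = (l₁ ≡ inside ⊎ l₂ ≡ outside) × l₁ ≢ outside × (l₁ ≡ inside → l₂ ≢ outside)

FenceHead₂ : Label → Label → Label → Maybe Label → Set
FenceHead₂ l₁ l₂ l₃ h =
  AllFirst (λ x → x ≡ inside ⊎ l₂ ≡ outside) h × (l₂ ≡ inside ⊎ l₃ ≡ outside) ×
  (l₂ ≡ outside → l₁ ≡ inside → ¬ AllFirst (_≡ inside) h) × (l₂ ≡ inside → l₃ ≢ outside)

FenceHead₃ : Label → Label → Set
FenceHead₃ l₂ l₃ = (l₃ ≡ outside → l₂ ≢ inside) × l₃ ≢ inside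

module SFenceHead {r : ℕ} (l₁ l₂ l₃ : Label) (τ : Labelling r) where

  module P₁ = Peel (CovF (3 + r)) (λ _ → ⊤) (λ _ → ⊤) l₁ (l₂ ∷ l₃ ∷ τ)
  module P₂ = Peel P₁.R′ P₁.U′ P₁.D′ l₂ (l₃ ∷ τ)
  module P₃ = Peel P₂.R′ P₂.U′ P₂.D′ l₃ τ

  x₄-covers : ∀ {P : Label → Set} →
              (∀ b → Cov 2 (3 + toℕ b) → P (lookup (l₃ ∷ τ) b)) ⇔ AllFirst P (first τ)
  x₄-covers = mk⇔
    (λ h → Equivalence.to (AllFirst-lookup τ) λ b b≡0 →
      h (suc b) (Equivalence.from Cov-2-up (cong suc b≡0)))
    (λ { h (suc b) c → Equivalence.from (AllFirst-lookup τ) h b (Fin-suc-injective (Equivalence.to Cov-2-up c)) })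
    where
    Fin-suc-injective : ∀ {i} → suc i ≡ 1 → i ≡ 0
    Fin-suc-injective refl = refl

  head₁ : P₁.HeadConditions ⇔ FenceHead₁ l₁ l₂
  head₁ = mk⇔
    (λ (_ , _ , c-down , out₀ , in₀) →
      c-down zero c21 , (λ l-out → out₀ l-out tt ((λ ()) , λ _ ())) ,
      (λ l-in l₂-out → in₀ l-in tt ((λ ()) , λ { zero _ → l₂-out })))
    (λ (compat , l₁-not-out , in-cond) →
      (λ ()) , (λ _ ()) , (λ { zero _ → compat }) , (λ l-out _ _ → l₁-not-out l-out) ,
      (λ l-in _ (_ , all-out) → in-cond l-in (all-out zero c21)))

  head₂ : P₂.HeadConditions ⇔ FenceHead₂ l₁ l₂ l₃ (first τ)
  head₂ = mk⇔
    (λ (_ , c-up , c-down , out₀ , in₀) →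
      Equivalence.to x₄-covers c-up , c-down zero c32 ,
      (λ l-out l₁-in all-in → out₀ l-out (tt , λ _ → l₁-in) ((λ ()) , Equivalence.from x₄-covers all-in)) ,
      (λ l-in l₃-out → in₀ l-in (tt , λ ()) ((λ ()) , λ { zero _ → l₃-out })))
    (λ (c-up , compat , out-cond , in-cond) →
      (λ ()) , Equivalence.from x₄-covers c-up , (λ { zero _ → compat }) ,
      (λ l-out (_ , l₁-in) (_ , all-in) → out-cond l-out (l₁-in c21) (Equivalence.to x₄-covers all-in)) ,
      (λ l-in _ (_ , all-out) → in-cond l-in (all-out zero c32)))

  head₃ : P₃.HeadConditions ⇔ FenceHead₃ l₂ l₃
  head₃ = mk⇔
    (λ (_ , _ , _ , out₀ , in₀) →
      (λ l-out l₂-in → out₀ l-out ((tt , λ ()) , λ _ → l₂-in) ((λ ()) , λ _ → ⊥-elim ∘ Cov-3-up)) ,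
      (λ l-in → in₀ l-in ((tt , λ ()) , λ ()) ((λ ()) , λ _ → ⊥-elim ∘ Cov-tail-to-head 3<4)))
    (λ (out-cond , l₃-not-in) →
      (λ ()) , (λ _ → ⊥-elim ∘ Cov-3-up) , (λ _ → ⊥-elim ∘ Cov-tail-to-head 3<4) ,
      (λ l-out (_ , l₂-in) _ → out-cond l-out (l₂-in c32)) ,
      (λ l-in _ _ → l₃-not-in l-in))

  tail : Admissible P₃.R′ P₃.U′ P₃.D′ τ ⇔ ZigzagAdmissible peak (isExtreme valley l₂) τ
  tail = admissible-cong (λ a b → Cov⇔peakCov) up down τ
    where
    up : ∀ a → P₃.U′ a ⇔ ImposedAt0 true a
    up a = imposedAt0-true a (mk⇔ (λ _ → tt) λ _ →
      ((tt , ⊥-elim ∘ Cov-tail-to-head 1<4) , ⊥-elim ∘ Cov-tail-to-head 2<4) , ⊥-elim ∘ Cov-tail-to-head 3<4)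
    down : ∀ a → P₃.D′ a ⇔ ImposedAt0 (isExtreme valley l₂) a
    down a = mk⇔
      (λ { ((_ , via-x₂) , _) a≡0 →
             Equivalence.from T-isExtreme (via-x₂ (subst (λ i → Cov 2 (4 + i)) (sym a≡0) c24)) })
      (λ g → ((tt , ⊥-elim ∘ Cov-1-up) , λ c → Equivalence.to T-isExtreme (g (Cov-2-x₄ c))) ,
             ⊥-elim ∘ Cov-3-up)
      where
      Cov-2-x₄ : ∀ {i} → Cov 2 (4 + i) → i ≡ 0
      Cov-2-x₄ c24 = refl

  valid⇔ : Valid (l₁ ∷ l₂ ∷ l₃ ∷ τ) ⇔
           ((FenceHead₁ l₁ l₂ × FenceHead₂ l₁ l₂ l₃ (first τ) × FenceHead₃ l₂ l₃) ×
            ZigzagAdmissible peak (isExtreme valley l₂) τ)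
  valid⇔ = mk⇔
    (λ v → let (h₁ , v₁) = Equivalence.to P₁.peel v
               (h₂ , v₂) = Equivalence.to P₂.peel v₁
               (h₃ , v₃) = Equivalence.to P₃.peel v₂
           in (Equivalence.to head₁ h₁ , Equivalence.to head₂ h₂ , Equivalence.to head₃ h₃) ,
              Equivalence.to tail v₃)
    (λ ((h₁ , h₂ , h₃) , z) →
      Equivalence.from P₁.peel (Equivalence.from head₁ h₁ ,
      Equivalence.from P₂.peel (Equivalence.from head₂ h₂ ,
      Equivalence.from P₃.peel (Equivalence.from head₃ h₃ , Equivalence.from tail z))))

fenceHead? : ∀ l₁ l₂ l₃ h → Dec (FenceHead₁ l₁ l₂ × FenceHead₂ l₁ l₂ l₃ h × FenceHead₃ l₂ l₃)
fenceHead? l₁ l₂ l₃ h =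
  (((l₁ ≟ˡ inside) ⊎-dec (l₂ ≟ˡ outside)) ×-dec ¬? (l₁ ≟ˡ outside) ×-dec
   ((l₁ ≟ˡ inside) →-dec ¬? (l₂ ≟ˡ outside))) ×-dec
  (allFirst? (λ x → (x ≟ˡ inside) ⊎-dec (l₂ ≟ˡ outside)) h ×-dec
   ((l₂ ≟ˡ inside) ⊎-dec (l₃ ≟ˡ outside)) ×-dec
   ((l₂ ≟ˡ outside) →-dec ((l₁ ≟ˡ inside) →-dec ¬? (allFirst? (_≟ˡ inside) h))) ×-dec
   ((l₂ ≟ˡ inside) →-dec ¬? (l₃ ≟ˡ outside))) ×-dec
  (((l₃ ≟ˡ outside) →-dec ¬? (l₂ ≟ˡ inside)) ×-dec ¬? (l₃ ≟ˡ inside))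

headAllowed : Label → Label → Label → Bool
headAllowed inside inside  free    = true
headAllowed inside free    outside = true
headAllowed free   outside outside = true
headAllowed _      _       _       = false

-- An inside x₂ serves x₄ as a free neighbour would.
start : Label → State
start outside = dominated
start _       = afterFree

-- Checked by evaluation over all 108 cases.
fenceHead⇔ : ∀ l₁ l₂ l₃ h → (FenceHead₁ l₁ l₂ × FenceHead₂ l₁ l₂ l₃ h × FenceHead₃ l₂ l₃) ⇔
                             (T (headAllowed l₁ l₂ l₃) × Pending peak (start l₂) h)
fenceHead⇔ l₁ l₂ l₃ h = dec-⇔ (fenceHead? l₁ l₂ l₃ h) (after? l₁ l₂ l₃ h) (table l₁ l₂ l₃ h)
  where
  after? : ∀ l₁ l₂ l₃ h → Dec (T (headAllowed l₁ l₂ l₃) × Pending peak (start l₂) h)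
  after? l₁ l₂ l₃ h = T? (headAllowed l₁ l₂ l₃) ×-dec pending? peak (start l₂) h
  table : ∀ l₁ l₂ l₃ h → does (fenceHead? l₁ l₂ l₃ h) ≡ does (after? l₁ l₂ l₃ h)
  table = toWitness {a? = ∀-label? λ l₁ → ∀-label? λ l₂ → ∀-label? λ l₃ → ∀-first? λ h →
                           does (fenceHead? l₁ l₂ l₃ h) ≟ᵇ does (after? l₁ l₂ l₃ h)} tt

isExtreme-start : ∀ l → isExtreme valley l ≡ fixedBefore (start l)
isExtreme-start inside  = refl
isExtreme-start free    = refl
isExtreme-start outside = refl

acceptsSFence : ∀ {n} → Labelling n → Bool
acceptsSFence (l₁ ∷ l₂ ∷ l₃ ∷ τ) = headAllowed l₁ l₂ l₃ ∧ accepts peak (start l₂) τ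
acceptsSFence _                  = false

valid⇔acceptsSFence : ∀ {r} (ℓ : Labelling (3 + r)) → Valid ℓ ⇔ T (acceptsSFence ℓ)
valid⇔acceptsSFence (l₁ ∷ l₂ ∷ l₃ ∷ τ) = mk⇔
  (λ v → let (h , z) = Equivalence.to (SFenceHead.valid⇔ l₁ l₂ l₃ τ) v
             (allowed₁ , pending) = Equivalence.to (fenceHead⇔ l₁ l₂ l₃ (first τ)) h
         in Equivalence.from T-∧ (allowed₁ , Equivalence.to (zigzag⇔accepts peak (start l₂) τ)
              (pending , subst (λ c → ZigzagAdmissible peak c τ) (isExtreme-start l₂) z)))
  (λ t → let (allowed₁ , rest) = Equivalence.to T-∧ t
             (pending , z) = Equivalence.from (zigzag⇔accepts peak (start l₂) τ) rest
         in Equivalence.from (SFenceHead.valid⇔ l₁ l₂ l₃ τ)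
              (Equivalence.from (fenceHead⇔ l₁ l₂ l₃ (first τ)) (allowed₁ , pending) ,
               subst (λ c → ZigzagAdmissible peak c τ) (sym (isExtreme-start l₂)) z))

-- Counting accepted labellings

acceptedOfDim : ∀ {r} → Parity → State → ℕ → Labelling r → Bool
acceptedOfDim p s k τ = accepts p s τ ∧ (dim τ ≡ᵇ k)

accepted : Parity → State → ℕ → ℕ → ℕ
accepted p s r k = count {r} (acceptedOfDim p s k)

-- Labellings accepted from state s whose dimension is k once a free label is put in front.
accepted⁺ : Parity → State → ℕ → ℕ → ℕ
accepted⁺ p s r zero    = 0
accepted⁺ p s r (suc k) = accepted p s r k

accepted⁺-count : ∀ p s r k → count {r} (λ τ → accepts p s τ ∧ (suc (dim τ) ≡ᵇ k)) ≡ accepted⁺ p s r k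
accepted⁺-count p s r zero    = count-false {r} _ λ τ → ∧-zeroʳ (accepts p s τ)
accepted⁺-count p s r (suc k) = refl

none-at : ∀ {n} (q : Labelling (suc n) → Bool) {l} → (∀ l′ τ → l′ ≢ l → q (l′ ∷ τ) ≡ false) →
          ∀ l′ → l′ ≢ l → count (q ∘ (l′ ∷_)) ≡ 0
none-at q others l′ l′≢l = count-false (q ∘ (l′ ∷_)) λ τ → others l′ τ l′≢l

count-only : ∀ {n} (q : Labelling (suc n) → Bool) l → (∀ l′ τ → l′ ≢ l → q (l′ ∷ τ) ≡ false) →
             count q ≡ count (q ∘ (l ∷_))
count-only q inside others = trans (count-suc q) (trans
  (cong₂ (λ a b → count (q ∘ (inside ∷_)) + (a + b)) (none-at q others free λ ()) (none-at q others outside λ ()))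
  (+-identityʳ _))
count-only q free others = trans (count-suc q) (trans
  (cong₂ (λ a b → a + (count (q ∘ (free ∷_)) + b)) (none-at q others inside λ ()) (none-at q others outside λ ()))
  (+-identityʳ _))
count-only q outside others = trans (count-suc q)
  (cong₂ (λ a b → a + (b + count (q ∘ (outside ∷_)))) (none-at q others inside λ ()) (none-at q others free λ ()))

accepted-afterFree : ∀ p r k → accepted p afterFree (suc r) k ≡ accepted (opposite p) dominated r k
accepted-afterFree peak r k = count-only {r} (acceptedOfDim peak afterFree k) inside
  λ { inside _ ne → ⊥-elim (ne refl) ; free _ _ → refl ; outside _ _ → refl }
accepted-afterFree valley r k = count-only {r} (acceptedOfDim valley afterFree k) outside
  λ { inside _ _ → refl ; free _ _ → refl ; outside _ ne → ⊥-elim (ne refl) }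

accepted-dominated : ∀ p r k →
  accepted p dominated (suc r) k ≡ accepted (opposite p) undominated r k + accepted⁺ (opposite p) afterFree r k
accepted-dominated peak r k = trans (count-suc {r} (acceptedOfDim peak dominated k))
  (trans (cong₂ (λ a b → accepted valley undominated r k + (a + b))
                (accepted⁺-count valley afterFree r k) (count-false {r} _ λ _ → refl))
         (cong (λ x → accepted valley undominated r k + x) (+-identityʳ _)))
accepted-dominated valley r k = trans (count-suc {r} (acceptedOfDim valley dominated k))
  (trans (cong₂ (λ a b → a + (b + accepted peak undominated r k))
                (count-false {r} _ λ _ → refl) (accepted⁺-count peak afterFree r k))
         (+-comm (accepted⁺ peak afterFree r k) _))

accepted-undominated : ∀ p r k → accepted p undominated (suc r) k ≡ accepted⁺ (opposite p) afterFree r k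
accepted-undominated p r k = trans
  (count-only {r} (acceptedOfDim p undominated k) free
     λ { inside τ _ → at-inside p {τ} ; free _ ne → ⊥-elim (ne refl) ; outside τ _ → at-outside p {τ} })
  (accepted⁺-count (opposite p) afterFree r k)
  where
  at-inside : ∀ p {τ : Labelling r} → (accepts p undominated (inside ∷ τ) ∧ (dim τ ≡ᵇ k)) ≡ false
  at-inside peak   = refl
  at-inside valley = refl
  at-outside : ∀ p {τ : Labelling r} → (accepts p undominated (outside ∷ τ) ∧ (dim τ ≡ᵇ k)) ≡ false
  at-outside peak   = refl
  at-outside valley = refl

excess : ℕ → ℕ → ℤ
excess r k = + r ℤ.- + (2 * k)

pascal : ∀ a w → binom (+ suc a) w ≡ binom (+ a) w + binom (+ a) (w ℤ.- + 1)
pascal a (+ zero)  = sym (+-identityʳ _)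
pascal a (+ suc b) = trans (sym (nCk+nC[k+1]≡[n+1]C[k+1] a b)) (+-comm (a C b) _)
pascal a -[1+ m ]  = refl

excess≡ : ∀ r k → excess r k ≡ + r ℤ.- + 2 ℤ.* + k
excess≡ r k = cong (λ t → + r ℤ.- t) (pos-* 2 k)

2[1+k]≡ : ∀ k → + (2 * suc k) ≡ + 2 ℤ.* (+ 1 ℤ.+ + k)
2[1+k]≡ k = trans (pos-* 2 (suc k)) (cong (λ t → + 2 ℤ.* t) (pos-+ 1 k))

excess-suc : ∀ r k → excess (suc r) k ≡ excess r k ℤ.+ + 1
excess-suc r k =
  trans (cong₂ ℤ._-_ (pos-+ 1 r) (pos-* 2 k))
        (trans (ring (+ r) (+ k)) (cong (ℤ._+ + 1) (sym (excess≡ r k))))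
  where
  ring : ∀ R K → (+ 1 ℤ.+ R) ℤ.- + 2 ℤ.* K ≡ (R ℤ.- + 2 ℤ.* K) ℤ.+ + 1
  ring = solve-∀

excess-suc-suc : ∀ r k → excess (suc r) (suc k) ℤ.+ + 1 ≡ excess r k
excess-suc-suc r k =
  trans (cong (ℤ._+ + 1) (cong₂ ℤ._-_ (pos-+ 1 r) (2[1+k]≡ k)))
        (trans (ring (+ r) (+ k)) (sym (excess≡ r k)))
  where
  ring : ∀ R K → ((+ 1 ℤ.+ R) ℤ.- + 2 ℤ.* (+ 1 ℤ.+ K)) ℤ.+ + 1 ≡ R ℤ.- + 2 ℤ.* K
  ring = solve-∀

excess-sucʳ : ∀ r k → excess r (suc k) ℤ.+ + 1 ≡ excess r k ℤ.- + 1
excess-sucʳ r k =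
  trans (cong (λ t → (+ r ℤ.- t) ℤ.+ + 1) (2[1+k]≡ k))
        (trans (ring (+ r) (+ k)) (cong (ℤ._- + 1) (sym (excess≡ r k))))
  where
  ring : ∀ R K → (R ℤ.- + 2 ℤ.* (+ 1 ℤ.+ K)) ℤ.+ + 1 ≡ (R ℤ.- + 2 ℤ.* K) ℤ.- + 1
  ring = solve-∀

excess-zero : ∀ k → excess 0 (suc k) ℤ.+ + 1 ≡ -[1+ 2 * k ]
excess-zero k =
  trans (cong (λ t → (+ 0 ℤ.- t) ℤ.+ + 1) (2[1+k]≡ k))
        (trans (ring (+ k)) (cong ℤ.-_ (sym (trans (pos-+ 1 (2 * k)) (cong (λ t → + 1 ℤ.+ t) (pos-* 2 k))))))
  where
  ring : ∀ K → (+ 0 ℤ.- + 2 ℤ.* (+ 1 ℤ.+ K)) ℤ.+ + 1 ≡ ℤ.- (+ 1 ℤ.+ + 2 ℤ.* K)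
  ring = solve-∀

excess-3+ : ∀ r k → + (3 + r) ℤ.- + (2 * suc k) ≡ excess r k ℤ.+ + 1
excess-3+ r k =
  trans (cong₂ ℤ._-_ (pos-+ 3 r) (2[1+k]≡ k))
        (trans (ring (+ r) (+ k)) (cong (ℤ._+ + 1) (sym (excess≡ r k))))
  where
  ring : ∀ R K → (+ 3 ℤ.+ R) ℤ.- + 2 ℤ.* (+ 1 ℤ.+ K) ≡ (R ℤ.- + 2 ℤ.* K) ℤ.+ + 1
  ring = solve-∀

closed : State → ℕ → ℕ → ℕ
closed afterFree   r k = binom (+ (k + 1)) (excess r k)
closed dominated   r k = binom (+ (k + 1)) (excess r k ℤ.+ + 1)
closed undominated r k = binom (+ k) (excess r k ℤ.+ + 1)

closed⁺ : State → ℕ → ℕ → ℕ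
closed⁺ s r zero    = 0
closed⁺ s r (suc k) = closed s r k

accepted≡closed : ∀ r p s k → accepted p s r k ≡ closed s r k
accepted⁺≡closed⁺ : ∀ r p s k → accepted⁺ p s r k ≡ closed⁺ s r k
accepted⁺≡closed⁺ r p s zero    = refl
accepted⁺≡closed⁺ r p s (suc k) = accepted≡closed r p s k

accepted≡closed zero p afterFree   zero    = refl
accepted≡closed zero p dominated   zero    = refl
accepted≡closed zero p undominated zero    = refl
accepted≡closed zero p afterFree   (suc k) = refl
accepted≡closed zero p dominated   (suc k) = sym (cong (binom (+ (suc k + 1))) (excess-zero k))
accepted≡closed zero p undominated (suc k) = sym (cong (binom (+ suc k)) (excess-zero k))
accepted≡closed (suc r) p afterFree k = begin
  accepted p afterFree (suc r) k            ≡⟨ accepted-afterFree p r k ⟩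
  accepted (opposite p) dominated r k       ≡⟨ accepted≡closed r (opposite p) dominated k ⟩
  binom (+ (k + 1)) (excess r k ℤ.+ + 1)    ≡⟨ cong (binom (+ (k + 1))) (sym (excess-suc r k)) ⟩
  closed afterFree (suc r) k                ∎
accepted≡closed (suc r) p dominated k = begin
  accepted p dominated (suc r) k
    ≡⟨ accepted-dominated p r k ⟩
  accepted (opposite p) undominated r k + accepted⁺ (opposite p) afterFree r k
    ≡⟨ cong₂ _+_ (accepted≡closed r (opposite p) undominated k)
                 (accepted⁺≡closed⁺ r (opposite p) afterFree k) ⟩
  closed undominated r k + closed⁺ afterFree r k
    ≡⟨ sym (pascal-dominated k) ⟩
  closed dominated (suc r) k ∎
  where
  pascal-dominated : ∀ k → closed dominated (suc r) k ≡ closed undominated r k + closed⁺ afterFree r k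
  pascal-dominated zero =
    trans (k>n⇒nCk≡0 (s≤s (m≤n+m 1 (r + 0)))) (sym (trans (+-identityʳ _) (k>n⇒nCk≡0 (m≤n+m 1 (r + 0)))))
  pascal-dominated (suc k) = begin
    binom (+ (suc k + 1)) (excess (suc r) (suc k) ℤ.+ + 1)
      ≡⟨ cong (binom (+ (suc k + 1))) (excess-suc-suc r k) ⟩
    binom (+ suc (k + 1)) (excess r k)
      ≡⟨ pascal (k + 1) (excess r k) ⟩
    binom (+ (k + 1)) (excess r k) + binom (+ (k + 1)) (excess r k ℤ.- + 1)
      ≡⟨ cong₂ (λ a w → binom (+ (k + 1)) (excess r k) + binom a w) (cong +_ (+-comm k 1)) (sym (excess-sucʳ r k)) ⟩
    closed⁺ afterFree r (suc k) + closed undominated r (suc k)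
      ≡⟨ +-comm (closed⁺ afterFree r (suc k)) _ ⟩
    closed undominated r (suc k) + closed⁺ afterFree r (suc k) ∎
accepted≡closed (suc r) p undominated k = begin
  accepted p undominated (suc r) k          ≡⟨ accepted-undominated p r k ⟩
  accepted⁺ (opposite p) afterFree r k      ≡⟨ accepted⁺≡closed⁺ r (opposite p) afterFree k ⟩
  closed⁺ afterFree r k                     ≡⟨ reindex k ⟩
  closed undominated (suc r) k              ∎
  where
  reindex : ∀ k → closed⁺ afterFree r k ≡ closed undominated (suc r) k
  reindex zero    = refl
  reindex (suc k) = cong₂ binom (cong +_ (+-comm k 1)) (sym (excess-suc-suc r k))

sFenceOfDim : ∀ {n} → ℕ → Labelling n → Bool
sFenceOfDim k ℓ = acceptsSFence ℓ ∧ (dim ℓ ≡ᵇ k)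

-- One summand for each admissible labelling of x₁ x₂ x₃: (inside, inside, free),
-- (inside, free, outside) and (free, outside, outside).
sFence-count : ∀ r k → count {3 + r} (sFenceOfDim k) ≡
  (accepted⁺ peak afterFree r k + accepted⁺ peak afterFree r k) + accepted⁺ peak dominated r k
sFence-count r k = begin
  count q
    ≡⟨ count-suc q ⟩
  count qᵢ + (count (q ∘ (free ∷_)) + count (q ∘ (outside ∷_)))
    ≡⟨ cong₂ (λ x y → x + (y + count (q ∘ (outside ∷_)))) (count-suc qᵢ) head-free ⟩
  (count (qᵢ ∘ (inside ∷_)) + (count (qᵢ ∘ (free ∷_)) + count (qᵢ ∘ (outside ∷_)))) + (b + count (q ∘ (outside ∷_)))
    ≡⟨ cong₂ _+_ (cong₂ _+_ head-inside-inside (cong₂ _+_ head-inside-free head-inside-outside))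
                 (cong (λ x → b + x) head-outside) ⟩
  (a + (a + 0)) + (b + 0)
    ≡⟨ cong₂ _+_ (cong (λ x → a + x) (+-identityʳ a)) (+-identityʳ b) ⟩
  (a + a) + b ∎
  where
  q : Labelling (3 + r) → Bool
  q = sFenceOfDim k
  qᵢ : Labelling (2 + r) → Bool
  qᵢ = q ∘ (inside ∷_)
  a b : ℕ
  a = accepted⁺ peak afterFree r k
  b = accepted⁺ peak dominated r k
  head-inside-inside : count (qᵢ ∘ (inside ∷_)) ≡ a
  head-inside-inside = trans
    (count-only (qᵢ ∘ (inside ∷_)) free
      λ { inside _ _ → refl ; free _ ne → ⊥-elim (ne refl) ; outside _ _ → refl })
    (accepted⁺-count peak afterFree r k)
  head-inside-free : count (qᵢ ∘ (free ∷_)) ≡ a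
  head-inside-free = trans
    (count-only (qᵢ ∘ (free ∷_)) outside
      λ { inside _ _ → refl ; free _ _ → refl ; outside _ ne → ⊥-elim (ne refl) })
    (accepted⁺-count peak afterFree r k)
  head-inside-outside : count (qᵢ ∘ (outside ∷_)) ≡ 0
  head-inside-outside = count-false (qᵢ ∘ (outside ∷_)) λ { (_ ∷ _) → refl }
  head-free : count (q ∘ (free ∷_)) ≡ b
  head-free = trans
    (count-only (q ∘ (free ∷_)) outside
      λ { inside (_ ∷ _) _ → refl ; free (_ ∷ _) _ → refl ; outside _ ne → ⊥-elim (ne refl) })
    (trans (count-only (q ∘ (free ∷_) ∘ (outside ∷_)) outside
             λ { inside _ _ → refl ; free _ _ → refl ; outside _ ne → ⊥-elim (ne refl) })
           (accepted⁺-count peak dominated r k))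
  head-outside : count (q ∘ (outside ∷_)) ≡ 0
  head-outside = count-false (q ∘ (outside ∷_)) λ { (_ ∷ _ ∷ _) → refl }

sFence-formula : ∀ r k → count {3 + r} (sFenceOfDim k) ≡
  binom (+ (k + 1)) (+ (3 + r) ℤ.- + (2 * k)) + binom (+ k) (+ (3 + r) ℤ.- + (2 * k) ℤ.- + 1)
sFence-formula r zero    = sFence-count r zero
sFence-formula r (suc k) = begin
  count {3 + r} (sFenceOfDim (suc k))
    ≡⟨ sFence-count r (suc k) ⟩
  (accepted peak afterFree r k + accepted peak afterFree r k) + accepted peak dominated r k
    ≡⟨ cong₂ _+_ (cong₂ _+_ (accepted≡closed r peak afterFree k) (accepted≡closed r peak afterFree k))
                 (accepted≡closed r peak dominated k) ⟩
  (A + A) + D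
    ≡⟨ trans (+-comm (A + A) D) (sym (+-assoc D A A)) ⟩
  (D + A) + A
    ≡⟨ cong₂ _+_ (sym larger) (sym smaller) ⟩
  binom (+ (suc k + 1)) (+ (3 + r) ℤ.- + (2 * suc k)) + binom (+ suc k) (+ (3 + r) ℤ.- + (2 * suc k) ℤ.- + 1) ∎
  where
  A D : ℕ
  A = closed afterFree r k
  D = closed dominated r k
  [z+1]-1 : ∀ z → (z ℤ.+ + 1) ℤ.- + 1 ≡ z
  [z+1]-1 = solve-∀
  larger : binom (+ (suc k + 1)) (+ (3 + r) ℤ.- + (2 * suc k)) ≡ D + A
  larger = begin
    binom (+ suc (k + 1)) (+ (3 + r) ℤ.- + (2 * suc k))
      ≡⟨ cong (binom (+ suc (k + 1))) (excess-3+ r k) ⟩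
    binom (+ suc (k + 1)) (excess r k ℤ.+ + 1)
      ≡⟨ pascal (k + 1) (excess r k ℤ.+ + 1) ⟩
    D + binom (+ (k + 1)) ((excess r k ℤ.+ + 1) ℤ.- + 1)
      ≡⟨ cong (λ w → D + binom (+ (k + 1)) w) ([z+1]-1 (excess r k)) ⟩
    D + A ∎
  smaller : binom (+ suc k) (+ (3 + r) ℤ.- + (2 * suc k) ℤ.- + 1) ≡ A
  smaller = cong₂ binom (cong +_ (+-comm 1 k))
                       (trans (cong (ℤ._- + 1) (excess-3+ r k)) ([z+1]-1 (excess r k)))

sFenceOfDim⇔ : ∀ {r} k (ℓ : Labelling (3 + r)) → T (sFenceOfDim k ℓ) ⇔ (Valid ℓ × dim ℓ ≡ k)
sFenceOfDim⇔ k ℓ = mk⇔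
  (λ t → let (acc , dim≡) = Equivalence.to T-∧ t
         in Equivalence.from (valid⇔acceptsSFence ℓ) acc , ≡ᵇ⇒≡ (dim ℓ) k dim≡)
  (λ (valid , dim≡) →
     Equivalence.from T-∧ (Equivalence.to (valid⇔acceptsSFence ℓ) valid , ≡⇒≡ᵇ (dim ℓ) k dim≡))

proposition8 : ∀ (n : ℕ) → 3 ≤ n → ∀ (k : ℕ) →
    h≡ n k (binom (+ (k + 1)) (+ n ℤ.- + (2 * k)) + binom (+ k) (+ n ℤ.- + (2 * k) ℤ.- + 1))
proposition8 (suc (suc (suc r))) (s≤s (s≤s (s≤s z≤n))) k =
  subst (h≡ (3 + r) k) (sFence-formula r k) (maxCubes-count (sFenceOfDim k) (sFenceOfDim⇔ k))
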